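{- For every positive integer $n$, $\operatorname{ord}_{s_{123,132}}(S_n) = 2\left\lfloor \frac{n-1}{2}\right\rfloor$.
   Context: $S_n$ is the set of permutations of $[n]=\{1,\dots,n\}$, written in one-line notation $\pi=\pi_1\pi_2\cdots\pi_n$. A sequence $a_1\cdots a_k$ of distinct integers contains the pattern $\tau\in S_k$... more precisely, a sequence of distinct integers contains a pattern $\tau\in S_m$ if it has a (not necessarily consecutive) subsequence whose entries are in the same relative order as $\tau$; otherwise it avoids $\tau$. The map $s_{123,132}:S_n\to S_n$ is defined as follows. The entries of $\pi$ are read from left to right and a single stack is used, initially empty, together with an output word, initially empty. At each step, if there is a remaining input entry $x$ and placing $x$ on top of the stack would produce a stack whose contents, read from top to bottom, avoid both patterns $123$ and $132$, then $x$ is pushed onto the stack (pushing has priority); otherwise the top entry of the stack is popped and appended to the output. When the input is exhausted, the remaining stack entries are popped one at a time from the top and appended to the output. The output is $s_{123,132}(\pi)$. A permutation $\pi$ is periodic under a map $f$ if $f^k(\pi)=\pi$ for some positive integer $k$. For a set $P$ of permutations, $\operatorname{ord}_{s_{123,132}}(P)$ is the smallest nonnegative integer $k$ such that every element of $s_{123,132}^k(P)$ is periodic under $s_{123,132}$. -}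

module Defs where

open import Data.Nat using (ℕ; zero; suc; _<ᵇ_; _≤_)
open import Data.Bool using (Bool; true; false; _∧_; not; if_then_else_)
open import Data.Bool.Properties using (_≟_)
open import Data.List using (List; []; _∷_; _++_; [_]; map; upTo; zip)
open import Data.Bool.ListAction using (any; all)
open import Data.Product using (_×_; _,_; Σ; ∃)
open import Relation.Binary.PropositionalEquality using (_≡_)
open import Relation.Nullary.Decidable using (⌊_⌋)
open import Data.List.Relation.Binary.Permutation.Propositional using (_↭_)

oneTo : ℕ → List ℕ
oneTo n = map suc (upTo n)

-- π ∈ S_n : π is a rearrangement of 1,...,n (one-line notation)
InS : ℕ → List ℕ → Set
InS n π = π ↭ oneTo n

subseqs : List ℕ → List (List ℕ)
subseqs [] = [] ∷ []
subseqs (x ∷ xs) = map (x ∷_) (subseqs xs) ++ subseqs xs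

_==_ : Bool → Bool → Bool
a == b = ⌊ a ≟ b ⌋

sameOrder : List ℕ → List ℕ → Bool
sameOrder [] [] = true
sameOrder (a ∷ as) (b ∷ bs) =
  all (λ { (a' , b') → (a <ᵇ a') == (b <ᵇ b') }) (zip as bs) ∧ sameOrder as bs
sameOrder _ _ = false

contains : List ℕ → List ℕ → Bool
contains σ τ = any (sameOrder τ) (subseqs σ)

avoids : List ℕ → List ℕ → Bool
avoids σ τ = not (contains σ τ)

stackOK : List ℕ → Bool
stackOK st = avoids st (1 ∷ 2 ∷ 3 ∷ []) ∧ avoids st (1 ∷ 3 ∷ 2 ∷ [])

-- Try to push x onto stack st (head = top); pop to output (in order) until
-- pushing is allowed. Returns (new stack, new output).
pushPop : ℕ → List ℕ → List ℕ → List ℕ × List ℕ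
pushPop x [] out = (x ∷ [] , out)
pushPop x (y ∷ ys) out =
  if stackOK (x ∷ y ∷ ys) then (x ∷ y ∷ ys , out) else pushPop x ys (out ++ [ y ])

run : List ℕ → List ℕ → List ℕ → List ℕ
run [] st out = out ++ st
run (x ∷ xs) st out with pushPop x st out
... | (st' , out') = run xs st' out'

s : List ℕ → List ℕ
s π = run π [] []

iter : ℕ → (List ℕ → List ℕ) → List ℕ → List ℕ
iter zero f x = x
iter (suc k) f x = f (iter k f x)

Periodic : List ℕ → Set
Periodic π = Σ ℕ λ k → (1 ≤ k) × (iter k s π ≡ π)

AllPeriodicAfter : ℕ → ℕ → Set
AllPeriodicAfter n k = (π : List ℕ) → InS n π → Periodic (iter k s π)

{-# OPTIONS --safe #-}
-- Pushing x keeps the stack avoiding 123 and 132 exactly when fewer than two entries of the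
-- stack exceed x. Two invariants hold after 2k steps (for n ≥ 2k + 1): every entry u ≤ 2k lies
-- among the last 2u positions, and the permutation is a prefix followed by the comb
-- k c₁ (k-1) c₂ … 1 cₖ with all cᵢ > k. If n ≤ 2k + 2 the prefix has at most two entries and s
-- merely rotates prefix and teeth, so every permutation is periodic after 2k steps. Conversely,
-- for n ≥ 2k + 3 a permutation made of three descending blocks reaches after 2k + 1 steps a
-- permutation with k + 1 right before a comb k. A periodic permutation is also reached after a
-- multiple of 2k + 2 steps, but then that position holds a tooth larger than k + 1.
module Submission where

open import Defs
open import Data.Bool using (Bool; true; false; _∧_; _∨_; not; if_then_else_)
open import Data.Bool.Properties using (∧-zeroʳ; ∧-identityʳ; ∨-zeroʳ; T-≡)
open import Data.Bool.ListAction using (any)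
open import Data.Empty using (⊥-elim)
open import Data.List
  using (List; []; _∷_; _++_; [_]; map; length; null; reverse; upTo; take; drop; applyUpTo; applyDownFrom; initLast; _∷ʳ′_)
open import Data.List.Properties
  using (++-assoc; ++-identityʳ; length-++; length-map; length-upTo; length-reverse; length-drop; ∷-injectiveˡ; ∷-injectiveʳ;
         ∷ʳ-injectiveˡ; reverse-++; unfold-reverse; take++drop≡id; reverse-applyUpTo; map-upTo)
open import Data.List.Membership.Propositional using (_∈_; _∉_)
open import Data.List.Membership.Propositional.Properties
  using (∈-∃++; ∈-++⁺ˡ; ∈-++⁺ʳ; ∈-++⁻; ∈-map⁺; ∈-map⁻; ∈-upTo⁺)
open import Data.List.Relation.Binary.Permutation.Propositional
  using (_↭_; ↭-sym; ↭-trans; ↭-reflexive; module PermutationReasoning)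
import Data.List.Relation.Binary.Permutation.Propositional.Properties as ↭
open import Data.List.Relation.Binary.Permutation.Propositional.Properties using (All-resp-↭; ∈-resp-↭)
open import Data.List.Relation.Binary.Sublist.Propositional using (_⊆_; []; _∷_; _∷ʳ_; ⊆-refl; ⊆-trans)
import Data.List.Relation.Binary.Sublist.Propositional.Properties as ⊆
open import Data.List.Relation.Unary.All using (All; []; _∷_; tabulate)
import Data.List.Relation.Unary.All as All
open import Data.List.Relation.Unary.All.Properties using (++⁺; ++⁻ˡ; ++⁻ʳ; All¬⇒¬Any)
open import Data.List.Relation.Unary.AllPairs using ([]; _∷_)
open import Data.List.Relation.Unary.Any using (here; there)
open import Data.List.Relation.Unary.Linked using (Linked; []; [-]; _∷_)
import Data.List.Relation.Unary.Linked.Properties as LinkedP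
open import Data.List.Relation.Unary.Unique.Propositional using (Unique)
import Data.List.Relation.Unary.Unique.Propositional.Properties as UniqueP
open import Data.Nat using (ℕ; zero; suc; _<ᵇ_; _≤_; _<_; _>_; _+_; _*_; _∸_; z≤n; s≤s; _≤?_; _<?_)
open import Data.Nat.Properties
open import Data.Nat.DivMod using (_/_; _%_; m≡m%n+[m/n]*n; m%n<n)
open import Data.Nat.Solver using (module +-*-Solver)
open +-*-Solver using (solve; _:+_; _:*_; _:=_; con)
open import Data.Product using (_×_; _,_; Σ; proj₁; proj₂; uncurry)
import Data.Product as Product
open import Data.Sum using (_⊎_; inj₁; inj₂)
import Data.Sum as Sum
open import Data.Unit using (⊤; tt)
open import Function using (case_of_)
open import Function.Bundles using (Equivalence)
open import Relation.Nullary using (¬_; yes; no)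
open import Relation.Binary.Definitions using (tri<; tri≈; tri>)
open import Relation.Binary.PropositionalEquality using (_≡_; refl; sym; trans; cong; cong₂; subst; module ≡-Reasoning)

<ᵇ≡true⇒< : {m n : ℕ} → (m <ᵇ n) ≡ true → m < n
<ᵇ≡true⇒< {m} {n} e = <ᵇ⇒< m n (Equivalence.from T-≡ e)

<⇒<ᵇ≡true : {m n : ℕ} → m < n → (m <ᵇ n) ≡ true
<⇒<ᵇ≡true lt = Equivalence.to T-≡ (<⇒<ᵇ lt)

≤⇒<ᵇ≡false : {m n : ℕ} → n ≤ m → (m <ᵇ n) ≡ false
≤⇒<ᵇ≡false {m} {n} le with m <ᵇ n in e
... | true = ⊥-elim (<⇒≱ (<ᵇ≡true⇒< e) le)
... | false = refl

<ᵇ≡false⇒≤ : {m n : ℕ} → (m <ᵇ n) ≡ false → n ≤ m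
<ᵇ≡false⇒≤ e = ≮⇒≥ (λ lt → case trans (sym (<⇒<ᵇ≡true lt)) e of λ ())

-- Pattern avoidance on the stack

countAbove : ℕ → List ℕ → ℕ
countAbove x [] = 0
countAbove x (y ∷ ys) = if x <ᵇ y then suc (countAbove x ys) else countAbove x ys

atMostOneAbove : List ℕ → Bool
atMostOneAbove [] = true
atMostOneAbove (y ∷ ys) = atMostOneAbove ys ∧ (countAbove y ys <ᵇ 2)

Pushable : List ℕ → ℕ → Set
Pushable st x = (countAbove x st <ᵇ 2) ≡ true

module _ {A : Set} where

  any-++ : (p : A → Bool) (xs ys : List A) → any p (xs ++ ys) ≡ any p xs ∨ any p ys
  any-++ p [] ys = refl
  any-++ p (x ∷ xs) ys with p x
  ... | true = refl
  ... | false = any-++ p xs ys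

  any-map : {B : Set} (p : B → Bool) (f : A → B) (xs : List A) → any p (map f xs) ≡ any (λ u → p (f u)) xs
  any-map p f [] = refl
  any-map p f (x ∷ xs) = cong (p (f x) ∨_) (any-map p f xs)

  any-cong : {p q : A → Bool} → (∀ u → p u ≡ q u) → (xs : List A) → any p xs ≡ any q xs
  any-cong e [] = refl
  any-cong e (x ∷ xs) = cong₂ _∨_ (e x) (any-cong e xs)

  any-∨ : (p q : A → Bool) (xs : List A) → any p xs ∨ any q xs ≡ any (λ u → p u ∨ q u) xs
  any-∨ p q [] = refl
  any-∨ p q (x ∷ xs) with p x | q x
  ... | true | _ = refl
  ... | false | true = ∨-zeroʳ (any p xs)
  ... | false | false = any-∨ p q xs

  any-∧ˡ : (c : Bool) (p : A → Bool) (xs : List A) → any (λ u → c ∧ p u) xs ≡ c ∧ any p xs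
  any-∧ˡ true p xs = refl
  any-∧ˡ false p [] = refl
  any-∧ˡ false p (x ∷ xs) = any-∧ˡ false p xs

contains-∷ : (x : ℕ) (st τ : List ℕ) →
  contains (x ∷ st) τ ≡ any (λ u → sameOrder τ (x ∷ u)) (subseqs st) ∨ contains st τ
contains-∷ x st τ = trans (any-++ (sameOrder τ) (map (x ∷_) (subseqs st)) (subseqs st))
  (cong (_∨ contains st τ) (any-map (sameOrder τ) (x ∷_) (subseqs st)))

oneAbove : ℕ → List ℕ → Bool
oneAbove x (b ∷ []) = x <ᵇ b
oneAbove x _ = false

twoAbove : ℕ → List ℕ → Bool
twoAbove x (a ∷ b ∷ []) = (x <ᵇ a) ∧ (x <ᵇ b)
twoAbove x _ = false

sameOrder-123∨132 : (x : ℕ) (u : List ℕ) →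
  sameOrder (1 ∷ 2 ∷ 3 ∷ []) (x ∷ u) ∨ sameOrder (1 ∷ 3 ∷ 2 ∷ []) (x ∷ u) ≡ twoAbove x u
sameOrder-123∨132 x [] = refl
sameOrder-123∨132 x (a ∷ []) with x <ᵇ a
... | true = refl
... | false = refl
sameOrder-123∨132 x (a ∷ b ∷ []) with x <ᵇ a | x <ᵇ b | a <ᵇ b
... | true  | true  | true  = refl
... | true  | true  | false = refl
... | true  | false | _     = refl
... | false | _     | _     = refl
sameOrder-123∨132 x (a ∷ b ∷ _ ∷ _) with x <ᵇ a | x <ᵇ b | a <ᵇ b
... | true  | true  | true  = refl
... | true  | true  | false = refl
... | true  | false | _     = refl
... | false | _     | _     = refl

twoAbove-∷ : (x y : ℕ) (u : List ℕ) → twoAbove x (y ∷ u) ≡ (x <ᵇ y) ∧ oneAbove x u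
twoAbove-∷ x y [] = sym (∧-zeroʳ _)
twoAbove-∷ x y (b ∷ []) = refl
twoAbove-∷ x y (b ∷ c ∷ r) = sym (∧-zeroʳ _)

oneAbove-∷ : (x y : ℕ) (u : List ℕ) → oneAbove x (y ∷ u) ≡ (x <ᵇ y) ∧ null u
oneAbove-∷ x y [] = sym (∧-identityʳ _)
oneAbove-∷ x y (b ∷ r) = sym (∧-zeroʳ _)

any-null-subseqs : (st : List ℕ) → any null (subseqs st) ≡ true
any-null-subseqs [] = refl
any-null-subseqs (y ∷ ys) = trans (any-++ null (map (y ∷_) (subseqs ys)) (subseqs ys))
  (trans (cong (any null (map (y ∷_) (subseqs ys)) ∨_) (any-null-subseqs ys)) (∨-zeroʳ _))

any-∷-subseqs : (p : List ℕ → Bool) (y : ℕ) (ys : List ℕ) →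
  any p (subseqs (y ∷ ys)) ≡ any (λ u → p (y ∷ u)) (subseqs ys) ∨ any p (subseqs ys)
any-∷-subseqs p y ys = trans (any-++ p (map (y ∷_) (subseqs ys)) (subseqs ys))
  (cong (_∨ any p (subseqs ys)) (any-map p (y ∷_) (subseqs ys)))

any-oneAbove-subseqs : (x : ℕ) (st : List ℕ) → any (oneAbove x) (subseqs st) ≡ (0 <ᵇ countAbove x st)
any-oneAbove-subseqs x [] = refl
any-oneAbove-subseqs x (y ∷ ys) = begin
  any (oneAbove x) (subseqs (y ∷ ys))
    ≡⟨ any-∷-subseqs (oneAbove x) y ys ⟩
  any (λ u → oneAbove x (y ∷ u)) (subseqs ys) ∨ any (oneAbove x) (subseqs ys)
    ≡⟨ cong₂ _∨_ (trans (any-cong (oneAbove-∷ x y) (subseqs ys)) (any-∧ˡ (x <ᵇ y) null (subseqs ys)))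
                 (any-oneAbove-subseqs x ys) ⟩
  ((x <ᵇ y) ∧ any null (subseqs ys)) ∨ (0 <ᵇ countAbove x ys)
    ≡⟨ cong (λ b → ((x <ᵇ y) ∧ b) ∨ (0 <ᵇ countAbove x ys)) (any-null-subseqs ys) ⟩
  ((x <ᵇ y) ∧ true) ∨ (0 <ᵇ countAbove x ys)
    ≡⟨ cases (x <ᵇ y) ⟩
  (0 <ᵇ countAbove x (y ∷ ys)) ∎
  where
  open ≡-Reasoning
  cases : (c : Bool) → (c ∧ true) ∨ (0 <ᵇ countAbove x ys) ≡
          (0 <ᵇ (if c then suc (countAbove x ys) else countAbove x ys))
  cases true = refl
  cases false = refl

any-twoAbove-subseqs : (x : ℕ) (st : List ℕ) → any (twoAbove x) (subseqs st) ≡ (1 <ᵇ countAbove x st)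
any-twoAbove-subseqs x [] = refl
any-twoAbove-subseqs x (y ∷ ys) = begin
  any (twoAbove x) (subseqs (y ∷ ys))
    ≡⟨ any-∷-subseqs (twoAbove x) y ys ⟩
  any (λ u → twoAbove x (y ∷ u)) (subseqs ys) ∨ any (twoAbove x) (subseqs ys)
    ≡⟨ cong₂ _∨_ (trans (any-cong (twoAbove-∷ x y) (subseqs ys)) (any-∧ˡ (x <ᵇ y) (oneAbove x) (subseqs ys)))
                 (any-twoAbove-subseqs x ys) ⟩
  ((x <ᵇ y) ∧ any (oneAbove x) (subseqs ys)) ∨ (1 <ᵇ countAbove x ys)
    ≡⟨ cong (λ b → ((x <ᵇ y) ∧ b) ∨ (1 <ᵇ countAbove x ys)) (any-oneAbove-subseqs x ys) ⟩
  ((x <ᵇ y) ∧ (0 <ᵇ countAbove x ys)) ∨ (1 <ᵇ countAbove x ys)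
    ≡⟨ cases (x <ᵇ y) (countAbove x ys) ⟩
  (1 <ᵇ countAbove x (y ∷ ys)) ∎
  where
  open ≡-Reasoning
  cases : (c : Bool) (k : ℕ) → (c ∧ (0 <ᵇ k)) ∨ (1 <ᵇ k) ≡ (1 <ᵇ (if c then suc k else k))
  cases true zero = refl
  cases true (suc k) = refl
  cases false k = refl

stackOK-∷ : (x : ℕ) (st : List ℕ) → stackOK (x ∷ st) ≡ stackOK st ∧ (countAbove x st <ᵇ 2)
stackOK-∷ x st = begin
  not (contains (x ∷ st) p₁) ∧ not (contains (x ∷ st) p₂)
    ≡⟨ cong₂ (λ a b → not a ∧ not b) (contains-∷ x st p₁) (contains-∷ x st p₂) ⟩
  not (starts p₁ ∨ contains st p₁) ∧ not (starts p₂ ∨ contains st p₂)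
    ≡⟨ regroup (starts p₁) (contains st p₁) (starts p₂) (contains st p₂) ⟩
  stackOK st ∧ not (starts p₁ ∨ starts p₂)
    ≡⟨ cong (λ b → stackOK st ∧ not b)
         (trans (any-∨ _ _ (subseqs st))
         (trans (any-cong (sameOrder-123∨132 x) (subseqs st)) (any-twoAbove-subseqs x st))) ⟩
  stackOK st ∧ not (1 <ᵇ countAbove x st)
    ≡⟨ cong (stackOK st ∧_) (not-1<ᵇ (countAbove x st)) ⟩
  stackOK st ∧ (countAbove x st <ᵇ 2) ∎
  where
  open ≡-Reasoning
  p₁ p₂ : List ℕ
  p₁ = 1 ∷ 2 ∷ 3 ∷ []
  p₂ = 1 ∷ 3 ∷ 2 ∷ []
  starts : List ℕ → Bool
  starts τ = any (λ u → sameOrder τ (x ∷ u)) (subseqs st)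
  regroup : (a₁ c₁ a₂ c₂ : Bool) → not (a₁ ∨ c₁) ∧ not (a₂ ∨ c₂) ≡ (not c₁ ∧ not c₂) ∧ not (a₁ ∨ a₂)
  regroup true c₁ a₂ c₂ = sym (∧-zeroʳ _)
  regroup false c₁ true c₂ = trans (∧-zeroʳ _) (sym (∧-zeroʳ _))
  regroup false c₁ false c₂ = sym (∧-identityʳ _)
  not-1<ᵇ : (k : ℕ) → not (1 <ᵇ k) ≡ (k <ᵇ 2)
  not-1<ᵇ zero = refl
  not-1<ᵇ (suc zero) = refl
  not-1<ᵇ (suc (suc k)) = refl

stackOK≡atMostOneAbove : (st : List ℕ) → stackOK st ≡ atMostOneAbove st
stackOK≡atMostOneAbove [] = refl
stackOK≡atMostOneAbove (x ∷ st) =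
  trans (stackOK-∷ x st) (cong (_∧ (countAbove x st <ᵇ 2)) (stackOK≡atMostOneAbove st))

-- The stack machine

-- (entries popped before x can be pushed , remaining stack)
pops : ℕ → List ℕ → List ℕ × List ℕ
pops x [] = [] , []
pops x (y ∷ ys) =
  if countAbove x (y ∷ ys) <ᵇ 2 then ([] , y ∷ ys) else (y ∷ proj₁ (pops x ys) , proj₂ (pops x ys))

Config : Set
Config = List ℕ × List ℕ

step : ℕ → Config → Config
step x (st , out) = x ∷ proj₂ (pops x st) , out ++ proj₁ (pops x st)

steps : List ℕ → Config → Config
steps [] σ = σ
steps (x ∷ xs) σ = steps xs (step x σ)

flush : Config → List ℕ
flush (st , out) = out ++ st

atMostOneAbove-tail : (y : ℕ) (ys : List ℕ) → atMostOneAbove (y ∷ ys) ≡ true → atMostOneAbove ys ≡ true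
atMostOneAbove-tail y ys e with atMostOneAbove ys
... | true = refl
... | false = e

pops-kept-atMostOneAbove : (x : ℕ) (st : List ℕ) →
  atMostOneAbove st ≡ true → atMostOneAbove (proj₂ (pops x st)) ≡ true
pops-kept-atMostOneAbove x [] e = refl
pops-kept-atMostOneAbove x (y ∷ ys) e with countAbove x (y ∷ ys) <ᵇ 2
... | true = e
... | false = pops-kept-atMostOneAbove x ys (atMostOneAbove-tail y ys e)

pops-kept-pushable : (x : ℕ) (st : List ℕ) → Pushable (proj₂ (pops x st)) x
pops-kept-pushable x [] = refl
pops-kept-pushable x (y ∷ ys) with countAbove x (y ∷ ys) <ᵇ 2 in eq
... | true = eq
... | false = pops-kept-pushable x ys

step-atMostOneAbove : (x : ℕ) (st out : List ℕ) →
  atMostOneAbove st ≡ true → atMostOneAbove (proj₁ (step x (st , out))) ≡ true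
step-atMostOneAbove x st out e
  rewrite pops-kept-atMostOneAbove x st e | pops-kept-pushable x st = refl

pushPop≡step : (x : ℕ) (st out : List ℕ) → atMostOneAbove st ≡ true → pushPop x st out ≡ step x (st , out)
pushPop≡step x [] out e = cong (λ o → (x ∷ [] , o)) (sym (++-identityʳ out))
pushPop≡step x (y ∷ ys) out e
  rewrite stackOK-∷ x (y ∷ ys) | stackOK≡atMostOneAbove (y ∷ ys) | e
  with countAbove x (y ∷ ys) <ᵇ 2
... | true = cong (λ o → (x ∷ y ∷ ys , o)) (sym (++-identityʳ out))
... | false = trans (pushPop≡step x ys (out ++ [ y ]) (atMostOneAbove-tail y ys e))
                    (cong (λ o → (x ∷ proj₂ (pops x ys) , o)) (++-assoc out [ y ] (proj₁ (pops x ys))))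

run≡flush-steps : (xs st out : List ℕ) → atMostOneAbove st ≡ true → run xs st out ≡ flush (steps xs (st , out))
run≡flush-steps [] st out e = refl
run≡flush-steps (x ∷ xs) st out e rewrite pushPop≡step x st out e =
  run≡flush-steps xs _ _ (step-atMostOneAbove x st out e)

s≡flush-steps : (π : List ℕ) → s π ≡ flush (steps π ([] , []))
s≡flush-steps π = run≡flush-steps π [] [] refl

pops-++ : (x : ℕ) (st : List ℕ) → proj₁ (pops x st) ++ proj₂ (pops x st) ≡ st
pops-++ x [] = refl
pops-++ x (y ∷ ys) with countAbove x (y ∷ ys) <ᵇ 2
... | true = refl
... | false = cong (y ∷_) (pops-++ x ys)

steps-++ : (xs ys : List ℕ) (σ : Config) → steps (xs ++ ys) σ ≡ steps ys (steps xs σ)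
steps-++ [] ys σ = refl
steps-++ (x ∷ xs) ys σ = steps-++ xs ys (step x σ)

steps-output-++ : (xs : List ℕ) (st o₁ o₂ : List ℕ) →
  steps xs (st , o₁ ++ o₂) ≡ (proj₁ (steps xs (st , o₂)) , o₁ ++ proj₂ (steps xs (st , o₂)))
steps-output-++ [] st o₁ o₂ = refl
steps-output-++ (x ∷ xs) st o₁ o₂ =
  trans (cong (λ o → steps xs (x ∷ proj₂ (pops x st) , o)) (++-assoc o₁ o₂ (proj₁ (pops x st))))
        (steps-output-++ xs (x ∷ proj₂ (pops x st)) o₁ (o₂ ++ proj₁ (pops x st)))

steps-↭ : (xs st out : List ℕ) →
  proj₂ (steps xs (st , out)) ++ proj₁ (steps xs (st , out)) ↭ out ++ st ++ xs
steps-↭ [] st out = ↭-reflexive (cong (out ++_) (sym (++-identityʳ st)))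
steps-↭ (x ∷ xs) st out = begin
  proj₂ (steps xs (x ∷ k , out ++ p)) ++ proj₁ (steps xs (x ∷ k , out ++ p)) ↭⟨ steps-↭ xs (x ∷ k) (out ++ p) ⟩
  (out ++ p) ++ x ∷ k ++ xs                   ≡⟨ ++-assoc out p (x ∷ k ++ xs) ⟩
  out ++ p ++ x ∷ k ++ xs                     ↭⟨ ↭.++⁺ˡ out (↭.++⁺ˡ p (↭-sym (↭.shift x k xs))) ⟩
  out ++ p ++ k ++ x ∷ xs                     ≡⟨ cong (out ++_) (sym (++-assoc p k (x ∷ xs))) ⟩
  out ++ (p ++ k) ++ x ∷ xs                   ≡⟨ cong (λ z → out ++ z ++ x ∷ xs) (pops-++ x st) ⟩
  out ++ st ++ x ∷ xs                         ∎
  where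
  open PermutationReasoning
  p = proj₁ (pops x st)
  k = proj₂ (pops x st)

s-↭ : (π : List ℕ) → s π ↭ π
s-↭ π = subst (_↭ π) (sym (s≡flush-steps π)) (steps-↭ π [] [])

flush-steps-extends : (xs st out : List ℕ) →
  Σ (List ℕ) λ z → flush (steps xs (st , out)) ≡ out ++ z × length z ≡ length st + length xs
flush-steps-extends xs st out = z , extends , len
  where
  σ = steps xs (st , [])
  z = proj₂ σ ++ proj₁ σ
  extends : flush (steps xs (st , out)) ≡ out ++ z
  extends = trans (cong (λ o → flush (steps xs (st , o))) (sym (++-identityʳ out)))
            (trans (cong flush (steps-output-++ xs st out [])) (++-assoc out (proj₂ σ) (proj₁ σ)))
  len : length z ≡ length st + length xs
  len = trans (↭.↭-length (steps-↭ xs st [])) (length-++ st)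

pushable-[_] : (a x : ℕ) → Pushable [ a ] x
pushable-[ a ] x with x <ᵇ a
... | true = refl
... | false = refl

pops-keeps-suffix : (x : ℕ) (st bot : List ℕ) → Pushable bot x →
  Σ (List ℕ) λ k → proj₂ (pops x (st ++ bot)) ≡ k ++ bot
pops-keeps-suffix x [] [] h = [] , refl
pops-keeps-suffix x [] (b ∷ bot) h rewrite h = [] , refl
pops-keeps-suffix x (y ∷ st) bot h with countAbove x (y ∷ st ++ bot) <ᵇ 2
... | true = y ∷ st , refl
... | false = pops-keeps-suffix x st bot h

steps-keeps-suffix : (xs bot : List ℕ) → All (Pushable bot) xs → (st out : List ℕ) →
  Σ (List ℕ) λ st′ → proj₁ (steps xs (st ++ bot , out)) ≡ st′ ++ bot
steps-keeps-suffix [] bot _ st out = st , refl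
steps-keeps-suffix (x ∷ xs) bot (px ∷ pxs) st out
  with pops x (st ++ bot) | pops-keeps-suffix x st bot px
... | p , k | k′ , refl = steps-keeps-suffix xs bot pxs (x ∷ k′) (out ++ p)

countAbove-antitone : {v x : ℕ} (ys : List ℕ) → v ≤ x → countAbove x ys ≤ countAbove v ys
countAbove-antitone [] le = z≤n
countAbove-antitone {v} {x} (y ∷ ys) le with x <ᵇ y in e₁ | v <ᵇ y in e₂
... | true | true = s≤s (countAbove-antitone ys le)
... | true | false = ⊥-elim (<⇒≱ (≤-<-trans le (<ᵇ≡true⇒< {x} {y} e₁)) (<ᵇ≡false⇒≤ {v} {y} e₂))
... | false | true = m≤n⇒m≤1+n (countAbove-antitone ys le)
... | false | false = countAbove-antitone ys le

countAbove-++ : (x : ℕ) (xs ys : List ℕ) → countAbove x (xs ++ ys) ≡ countAbove x xs + countAbove x ys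
countAbove-++ x [] ys = refl
countAbove-++ x (y ∷ xs) ys with x <ᵇ y
... | true = cong suc (countAbove-++ x xs ys)
... | false = countAbove-++ x xs ys

countAbove-↭ : (x : ℕ) {xs ys : List ℕ} → xs ↭ ys → countAbove x xs ≡ countAbove x ys
countAbove-↭ x _↭_.refl = refl
countAbove-↭ x (_↭_.prep y p) with x <ᵇ y
... | true = cong suc (countAbove-↭ x p)
... | false = countAbove-↭ x p
countAbove-↭ x (_↭_.swap a b p) with x <ᵇ a | x <ᵇ b
... | true | true = cong (λ z → suc (suc z)) (countAbove-↭ x p)
... | true | false = cong suc (countAbove-↭ x p)
... | false | true = cong suc (countAbove-↭ x p)
... | false | false = countAbove-↭ x p
countAbove-↭ x (_↭_.trans p q) = trans (countAbove-↭ x p) (countAbove-↭ x q)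

countAbove-all : {v : ℕ} (ys : List ℕ) → All (v <_) ys → countAbove v ys ≡ length ys
countAbove-all [] [] = refl
countAbove-all (y ∷ ys) (py ∷ pys) rewrite <⇒<ᵇ≡true py = cong suc (countAbove-all ys pys)

⊆-++-split : (ys₁ ys₂ : List ℕ) {xs : List ℕ} → xs ⊆ ys₁ ++ ys₂ →
  Σ (List ℕ) λ xs₁ → Σ (List ℕ) λ xs₂ → (xs ≡ xs₁ ++ xs₂) × (xs₁ ⊆ ys₁) × (xs₂ ⊆ ys₂)
⊆-++-split [] ys₂ h = [] , _ , refl , [] , h
⊆-++-split (y ∷ ys₁) ys₂ (.y ∷ʳ h) with ⊆-++-split ys₁ ys₂ h
... | xs₁ , xs₂ , e , h₁ , h₂ = xs₁ , xs₂ , e , y ∷ʳ h₁ , h₂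
⊆-++-split (y ∷ ys₁) ys₂ (refl ∷ h) with ⊆-++-split ys₁ ys₂ h
... | xs₁ , xs₂ , e , h₁ , h₂ = y ∷ xs₁ , xs₂ , cong (y ∷_) e , refl ∷ h₁ , h₂

unique-↭ : {xs ys : List ℕ} → xs ↭ ys → Unique xs → Unique ys
unique-↭ _↭_.refl u = u
unique-↭ (_↭_.prep x p) (h ∷ u) = All-resp-↭ p h ∷ unique-↭ p u
unique-↭ (_↭_.swap x y p) ((x≢y ∷ hx) ∷ hy ∷ u) =
  ((λ e → x≢y (sym e)) ∷ All-resp-↭ p hy) ∷ All-resp-↭ p hx ∷ unique-↭ p u
unique-↭ (_↭_.trans p q) u = unique-↭ q (unique-↭ p u)

unique-++ˡ : (xs : List ℕ) {ys : List ℕ} → Unique (xs ++ ys) → Unique xs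
unique-++ˡ [] u = []
unique-++ˡ (x ∷ xs) (h ∷ u) = ++⁻ˡ xs h ∷ unique-++ˡ xs u

unique-∉-prefix : (β : List ℕ) {u : ℕ} {γ : List ℕ} → Unique (β ++ u ∷ γ) → u ∉ β
unique-∉-prefix (b ∷ β) (h ∷ un) (here refl) = All¬⇒¬Any h (∈-++⁺ʳ β (here refl))
unique-∉-prefix (b ∷ β) (h ∷ un) (there m) = unique-∉-prefix β un m

unique-∉-suffix : (β : List ℕ) {u : ℕ} {γ : List ℕ} → Unique (β ++ u ∷ γ) → u ∉ γ
unique-∉-suffix [] (h ∷ _) m = All¬⇒¬Any h m
unique-∉-suffix (b ∷ β) (_ ∷ un) m = unique-∉-suffix β un m

unique-suffix-after : (β β′ : List ℕ) {u : ℕ} {γ γ′ : List ℕ} →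
  Unique (β ++ u ∷ γ) → β ++ u ∷ γ ≡ β′ ++ u ∷ γ′ → γ ≡ γ′
unique-suffix-after [] [] un refl = refl
unique-suffix-after [] (b ∷ β′) (h ∷ _) refl = ⊥-elim (All¬⇒¬Any h (∈-++⁺ʳ β′ (here refl)))
unique-suffix-after (b ∷ β) [] (h ∷ _) refl = ⊥-elim (All¬⇒¬Any h (∈-++⁺ʳ β (here refl)))
unique-suffix-after (b ∷ β) (b′ ∷ β′) (_ ∷ un) e = unique-suffix-after β β′ un (∷-injectiveʳ e)

∈-oneTo⁺ : {n x : ℕ} → 1 ≤ x → x ≤ n → x ∈ oneTo n
∈-oneTo⁺ {n} {suc y} (s≤s _) le = ∈-map⁺ suc (∈-upTo⁺ le)

InS-unique : {n : ℕ} {π : List ℕ} → InS n π → Unique π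
InS-unique p = unique-↭ (↭-sym p) (UniqueP.map⁺ suc-injective (UniqueP.upTo⁺ _))

InS-length : {n : ℕ} {π : List ℕ} → InS n π → length π ≡ n
InS-length {n} p = trans (↭.↭-length p) (trans (length-map suc (upTo n)) (length-upTo n))

InS-positive : {n : ℕ} {π : List ℕ} → InS n π → All (0 <_) π
InS-positive p = tabulate λ m → case ∈-map⁻ suc (∈-resp-↭ p m) of λ { (_ , _ , refl) → s≤s z≤n }

InS-s : {n : ℕ} {π : List ℕ} → InS n π → InS n (s π)
InS-s p = ↭-trans (s-↭ _) p

-- How far an entry moves towards the end

WithinLast : ℕ → ℕ → List ℕ → Set
WithinLast L u ρ = Σ (List ℕ) λ β → Σ (List ℕ) λ γ → (ρ ≡ β ++ u ∷ γ) × (length γ < L)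

WithinLast-unique : {L u : ℕ} {ρ : List ℕ} (β : List ℕ) {γ : List ℕ} →
  Unique ρ → ρ ≡ β ++ u ∷ γ → WithinLast L u ρ → length γ < L
WithinLast-unique β {γ} un refl (β′ , γ′ , e , lt) =
  subst (λ z → length z < _) (unique-suffix-after β′ β (subst Unique e un) (sym e)) lt

pushable-below : {v x : ℕ} (B : List ℕ) → Pushable B v → v ≤ x → Pushable (v ∷ B) x
pushable-below {v} {x} B h v≤x rewrite ≤⇒<ᵇ≡false v≤x =
  <⇒<ᵇ≡true (≤-<-trans (countAbove-antitone B v≤x) (<ᵇ≡true⇒< {n = 2} h))

pops-around : (x v : ℕ) (T B : List ℕ) → Pushable B v →
  (Σ (List ℕ) λ p → Σ (List ℕ) λ T′ → pops x (T ++ v ∷ B) ≡ (p , T′ ++ v ∷ B))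
  ⊎ ((x < v) × (Σ (List ℕ) λ p → Σ (List ℕ) λ k →
                 (pops x (T ++ v ∷ B) ≡ (T ++ v ∷ p , k)) × (p ++ k ≡ B)))
pops-around x v [] B h with countAbove x (v ∷ B) <ᵇ 2 in e
... | true = inj₁ ([] , [] , refl)
... | false = inj₂ (x<v , proj₁ (pops x B) , proj₂ (pops x B) , refl , pops-++ x B)
  where
  x<v : x < v
  x<v = ≰⇒> λ v≤x → case trans (sym (pushable-below B h v≤x)) e of λ ()
pops-around x v (t ∷ T) B h with countAbove x (t ∷ T ++ v ∷ B) <ᵇ 2
... | true = inj₁ ([] , t ∷ T , refl)
... | false with pops-around x v T B h
... | inj₁ (p , T′ , e) = inj₁ (t ∷ p , T′ , cong (Product.map₁ (t ∷_)) e)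
... | inj₂ (lt , p , k , e , sp) = inj₂ (lt , p , k , cong (Product.map₁ (t ∷_)) e , sp)

HeadBelow : ℕ → List ℕ → Set
HeadBelow v [] = ⊤
HeadBelow v (x ∷ _) = x < v

record Landing (v : ℕ) (B S final : List ℕ) : Set where
  field
    before after skipped rest : List ℕ
    final≡ : final ≡ before ++ v ∷ after
    S≡ : S ≡ skipped ++ rest
    length-after : length after ≡ length B + length rest
    rest-head : HeadBelow v rest

Landing-skip : {v : ℕ} {B S final : List ℕ} (x : ℕ) → Landing v B S final → Landing v B (x ∷ S) final
Landing-skip x L = record
  { before = before ; after = after ; skipped = x ∷ skipped ; rest = rest
  ; final≡ = final≡ ; S≡ = cong (x ∷_) S≡ ; length-after = length-after ; rest-head = rest-head }
  where open Landing L

-- Once v is on the stack above B, it stays until the first smaller entry x arrives; then v is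
-- output, and only entries of B, x and the input after x end up behind it.
landing : (v : ℕ) (B : List ℕ) → Pushable B v → (S T out : List ℕ) →
  Landing v B S (flush (steps S (T ++ v ∷ B , out)))
landing v B h [] T out =
  record { before = out ++ T ; after = B ; skipped = [] ; rest = []
         ; final≡ = sym (++-assoc out T (v ∷ B)) ; S≡ = refl
         ; length-after = sym (+-identityʳ _) ; rest-head = tt }
landing v B h (x ∷ S) T out with pops-around x v T B h
... | inj₁ (p , T′ , e) rewrite e = Landing-skip x (landing v B h S (x ∷ T′) (out ++ p))
... | inj₂ (x<v , p , k , e , p++k≡B) rewrite e with flush-steps-extends S (x ∷ k) (out ++ (T ++ v ∷ p))
... | z , extends , length-z =
  record { before = out ++ T ; after = p ++ z ; skipped = [] ; rest = x ∷ S
         ; final≡ = final≡ ; S≡ = refl ; length-after = length-after ; rest-head = x<v }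
  where
  open ≡-Reasoning
  final≡ : flush (steps S (x ∷ k , out ++ (T ++ v ∷ p))) ≡ (out ++ T) ++ v ∷ (p ++ z)
  final≡ = begin
    flush (steps S (x ∷ k , out ++ (T ++ v ∷ p))) ≡⟨ extends ⟩
    (out ++ (T ++ v ∷ p)) ++ z                   ≡⟨ cong (_++ z) (sym (++-assoc out T (v ∷ p))) ⟩
    ((out ++ T) ++ v ∷ p) ++ z                   ≡⟨ ++-assoc (out ++ T) (v ∷ p) z ⟩
    (out ++ T) ++ v ∷ (p ++ z)                   ∎
  length-after : length (p ++ z) ≡ length B + length (x ∷ S)
  length-after = begin
    length (p ++ z)                        ≡⟨ trans (length-++ p) (cong (length p +_) length-z) ⟩
    length p + (suc (length k) + length S) ≡⟨ solve 3 (λ a b c → a :+ (con 1 :+ b :+ c) := (a :+ b) :+ (con 1 :+ c)) refl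
                                                (length p) (length k) (length S) ⟩
    (length p + length k) + suc (length S) ≡⟨ cong (_+ suc (length S)) (trans (sym (length-++ p)) (cong length p++k≡B)) ⟩
    length B + length (x ∷ S)              ∎

reverse-kept-⊆ : (x : ℕ) (st : List ℕ) → reverse (proj₂ (pops x st)) ⊆ reverse st
reverse-kept-⊆ x st =
  subst (λ z → reverse k ⊆ reverse z) (pops-++ x st)
    (subst (reverse k ⊆_) (sym (reverse-++ p k)) (⊆.++⁺ʳ (reverse p) ⊆-refl))
  where
  p = proj₁ (pops x st)
  k = proj₂ (pops x st)

steps-stack-⊆ : (xs st out Q : List ℕ) → reverse st ⊆ Q → reverse (proj₁ (steps xs (st , out))) ⊆ Q ++ xs
steps-stack-⊆ [] st out Q h = subst (reverse st ⊆_) (sym (++-identityʳ Q)) h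
steps-stack-⊆ (x ∷ xs) st out Q h =
  subst (reverse (proj₁ (steps xs (x ∷ k , out ++ p))) ⊆_) (++-assoc Q [ x ] xs)
    (steps-stack-⊆ xs (x ∷ k) (out ++ p) (Q ++ [ x ])
      (subst (_⊆ Q ++ [ x ]) (sym (unfold-reverse x k)) (⊆.++⁺ (⊆-trans (reverse-kept-⊆ x st) h) ⊆-refl)))
  where
  p = proj₁ (pops x st)
  k = proj₂ (pops x st)

-- At most one entry of a pushable stack B exceeds v, so B has at most one entry taken from P₁.
kept-length-bound : {v : ℕ} (B P₁ P₂ : List ℕ) → reverse B ⊆ P₁ ++ P₂ → All (v <_) P₁ → Pushable B v →
  length B ≤ suc (length P₂)
kept-length-bound {v} B P₁ P₂ sub above h with ⊆-++-split P₁ P₂ sub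
... | B₁ , B₂ , e , h₁ , h₂ = begin
  length B              ≡⟨ sym (length-reverse B) ⟩
  length (reverse B)    ≡⟨ trans (cong length e) (length-++ B₁) ⟩
  length B₁ + length B₂ ≤⟨ +-mono-≤ B₁≤1 (⊆.length-mono-≤ h₂) ⟩
  suc (length P₂)       ∎
  where
  open ≤-Reasoning
  B₁≤1 : length B₁ ≤ 1
  B₁≤1 = begin
    length B₁                           ≡⟨ sym (countAbove-all B₁ (⊆.All-resp-⊆ h₁ above)) ⟩
    countAbove v B₁                     ≤⟨ m≤m+n _ _ ⟩
    countAbove v B₁ + countAbove v B₂   ≡⟨ sym (countAbove-++ v B₁ B₂) ⟩
    countAbove v (B₁ ++ B₂)             ≡⟨ cong (countAbove v) (sym e) ⟩
    countAbove v (reverse B)            ≡⟨ countAbove-↭ v (↭.↭-reverse B) ⟩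
    countAbove v B                      ≤⟨ ≤-pred (<ᵇ≡true⇒< {n = 2} h) ⟩
    1                                   ∎

splitAtLast : (P : List ℕ) (M : ℕ) → Σ (List ℕ) λ P₁ → Σ (List ℕ) λ P₂ →
  (P ≡ P₁ ++ P₂) × (length P₂ ≤ M) × ((P₁ ≡ []) ⊎ (length P₂ ≡ M))
splitAtLast P M with M ≤? length P
... | yes M≤ = take k P , drop k P , sym (take++drop≡id k P) , ≤-reflexive len , inj₂ len
  where
  k = length P ∸ M
  len : length (drop k P) ≡ M
  len = trans (length-drop k P) (m∸[m∸n]≡n M≤)
... | no M≰ = [] , P , refl , <⇒≤ (≰⇒> M≰) , inj₁ refl

module _ (P S : List ℕ) (w : ℕ) (un : Unique (P ++ suc w ∷ S))
         (near : ∀ u → u ≤ w → u ∈ P ++ suc w ∷ S → WithinLast (2 * u) u (P ++ suc w ∷ S)) where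

  private
    v = suc w
    ρ = P ++ v ∷ S
    σ = steps P ([] , [])
    B = proj₂ (pops v (proj₁ σ))
    M = 2 * w ∸ suc (length S)

  -- Entries of P before its last M are too far from the end of ρ to be smaller than v.
  far-entries-above : (P₁ P₂ : List ℕ) → P ≡ P₁ ++ P₂ → (P₁ ≡ []) ⊎ (length P₂ ≡ M) → All (v <_) P₁
  far-entries-above P₁ P₂ P≡ (inj₁ refl) = []
  far-entries-above P₁ P₂ P≡ (inj₂ |P₂|≡M) = tabulate above
    where
    above : ∀ {u} → u ∈ P₁ → v < u
    above {u} u∈P₁ with ∈-∃++ u∈P₁
    ... | P₁ᵃ , P₁ᵇ , refl with <-cmp v u
    ... | tri< v<u _ _ = v<u
    ... | tri≈ _ refl _ = ⊥-elim (unique-∉-prefix P un (subst (u ∈_) (sym P≡) (∈-++⁺ˡ u∈P₁)))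
    ... | tri> _ _ (s≤s u≤w) = ⊥-elim (<⇒≱ (WithinLast-unique P₁ᵃ un ρ≡ (near u u≤w u∈ρ)) far)
      where
      ρ≡ : ρ ≡ P₁ᵃ ++ u ∷ (P₁ᵇ ++ P₂ ++ v ∷ S)
      ρ≡ = trans (cong (_++ v ∷ S) P≡)
             (trans (++-assoc (P₁ᵃ ++ u ∷ P₁ᵇ) P₂ (v ∷ S)) (++-assoc P₁ᵃ (u ∷ P₁ᵇ) (P₂ ++ v ∷ S)))
      u∈ρ : u ∈ ρ
      u∈ρ = subst (u ∈_) (sym ρ≡) (∈-++⁺ʳ P₁ᵃ (here refl))
      far : 2 * u ≤ length (P₁ᵇ ++ P₂ ++ v ∷ S)
      far = begin
        2 * u                               ≤⟨ *-monoʳ-≤ 2 u≤w ⟩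
        2 * w                               ≤⟨ m≤n+m∸n (2 * w) (suc (length S)) ⟩
        suc (length S) + M                  ≡⟨ +-comm (suc (length S)) M ⟩
        M + suc (length S)                  ≡⟨ cong (_+ suc (length S)) (sym |P₂|≡M) ⟩
        length P₂ + suc (length S)          ≤⟨ m≤n+m _ (length P₁ᵇ) ⟩
        length P₁ᵇ + (length P₂ + suc (length S))
          ≡⟨ sym (trans (length-++ P₁ᵇ) (cong (length P₁ᵇ +_) (length-++ P₂))) ⟩
        length (P₁ᵇ ++ P₂ ++ v ∷ S)         ∎
        where open ≤-Reasoning

  kept-length : length B ≤ suc M
  kept-length with splitAtLast P M
  ... | P₁ , P₂ , P≡ , |P₂|≤M , short =
    ≤-trans (kept-length-bound B P₁ P₂ B⊆ (far-entries-above P₁ P₂ P≡ short) (pops-kept-pushable v (proj₁ σ)))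
            (s≤s |P₂|≤M)
    where
    B⊆ : reverse B ⊆ P₁ ++ P₂
    B⊆ = subst (reverse B ⊆_) P≡ (⊆-trans (reverse-kept-⊆ v (proj₁ σ)) (steps-stack-⊆ P [] [] [] []))

  rest-length : (skipped Y : List ℕ) → S ≡ skipped ++ Y → HeadBelow v Y → length Y ≤ 2 * w
  rest-length skipped [] _ _ = z≤n
  rest-length skipped (x ∷ Y) S≡ (s≤s x≤w) =
    ≤-trans (WithinLast-unique (P ++ v ∷ skipped) un ρ≡ (near x x≤w x∈ρ)) (*-monoʳ-≤ 2 x≤w)
    where
    ρ≡ : ρ ≡ (P ++ v ∷ skipped) ++ x ∷ Y
    ρ≡ = trans (cong (λ z → P ++ v ∷ z) S≡) (sym (++-assoc P (v ∷ skipped) (x ∷ Y)))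
    x∈ρ : x ∈ ρ
    x∈ρ = subst (x ∈_) (sym ρ≡) (∈-++⁺ʳ (P ++ v ∷ skipped) (here refl))

  -- Behind v in s ρ come the stack B below v, which holds one entry above v and otherwise entries
  -- among the last M of P, and then the input from the first entry smaller than v on.
  s-WithinLast : WithinLast (2 * v) v (s ρ)
  s-WithinLast = before , after , trans s≡ final≡ , after<
    where
    L = landing v B (pops-kept-pushable v (proj₁ σ)) S [] (proj₂ σ ++ proj₁ (pops v (proj₁ σ)))
    open Landing L
    s≡ : s ρ ≡ flush (steps S (v ∷ B , proj₂ σ ++ proj₁ (pops v (proj₁ σ))))
    s≡ = trans (s≡flush-steps ρ) (cong flush (steps-++ P (v ∷ S) ([] , [])))
    rest≤S : length rest ≤ suc (length S)
    rest≤S = m≤n⇒m≤1+n (subst (λ z → length rest ≤ length z) (sym S≡)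
               (subst (length rest ≤_) (sym (length-++ skipped)) (m≤n+m _ _)))
    after< : length after < 2 * v
    after< = begin-strict
      length after                ≡⟨ length-after ⟩
      length B + length rest      ≤⟨ +-monoˡ-≤ (length rest) kept-length ⟩
      suc (M + length rest)       ≤⟨ s≤s (+-monoˡ-≤ (length rest) (∸-monoʳ-≤ (2 * w) rest≤S)) ⟩
      suc (2 * w ∸ length rest + length rest)
        ≡⟨ cong suc (m∸n+n≡m (rest-length skipped rest S≡ rest-head)) ⟩
      suc (2 * w)                 <⟨ n<1+n _ ⟩
      2 + 2 * w                   ≡⟨ sym (*-suc 2 w) ⟩
      2 * v                       ∎
      where open ≤-Reasoning

-- Combs

comb : ℕ → List ℕ → List ℕ
comb (suc k) (c ∷ cs) = suc k ∷ c ∷ comb k cs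
comb _ _ = []

comb′ : ℕ → List ℕ → List ℕ
comb′ k [] = []
comb′ k (c ∷ cs) = c ∷ comb k cs

comb-∷ʳ : (k : ℕ) (cs : List ℕ) (a : ℕ) → comb (suc k) (cs ++ [ a ]) ≡ suc k ∷ comb′ k (cs ++ [ a ])
comb-∷ʳ k [] a = refl
comb-∷ʳ k (c ∷ cs) a = refl

length-comb : (k : ℕ) (cs : List ℕ) → length cs ≡ k → length (comb k cs) ≡ k + k
length-comb zero [] refl = refl
length-comb (suc k) (c ∷ cs) e = cong suc (trans (cong suc (length-comb k cs (suc-injective e))) (sym (+-suc k k)))

∈-comb : (k : ℕ) (cs : List ℕ) {x : ℕ} → x ∈ comb k cs → (x ≤ k) ⊎ (x ∈ cs)
∈-comb (suc k) (c ∷ cs) (here refl) = inj₁ ≤-refl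
∈-comb (suc k) (c ∷ cs) (there (here refl)) = inj₂ (here refl)
∈-comb (suc k) (c ∷ cs) (there (there m)) with ∈-comb k cs m
... | inj₁ le = inj₁ (m≤n⇒m≤1+n le)
... | inj₂ m′ = inj₂ (there m′)

length-∷ʳ : (cs : List ℕ) (a : ℕ) → length (cs ++ [ a ]) ≡ suc (length cs)
length-∷ʳ cs a = trans (length-++ cs) (+-comm (length cs) 1)

pops-pushable : (x : ℕ) (st : List ℕ) → Pushable st x → pops x st ≡ ([] , st)
pops-pushable x [] h = refl
pops-pushable x (y ∷ ys) h rewrite h = refl

pushable-∷-below : {b x : ℕ} (bot : List ℕ) → b ≤ x → Pushable bot x → Pushable (b ∷ bot) x
pushable-∷-below {b} {x} bot b≤x h rewrite ≤⇒<ᵇ≡false b≤x = h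

pops-all-above : {x : ℕ} (st : List ℕ) (a : ℕ) → All (x <_) st → x < a → pops x (st ++ [ a ]) ≡ (st , [ a ])
pops-all-above {x} [] a [] x<a = pops-pushable x [ a ] (pushable-[ a ] x)
pops-all-above {x} (y ∷ st) a (x<y ∷ above) x<a
  rewrite ≤⇒<ᵇ≡false {countAbove x (y ∷ st ++ [ a ])} {2}
            (subst (2 ≤_) (sym (countAbove-all (y ∷ st ++ [ a ]) (x<y ∷ ++⁺ above (x<a ∷ []))))
              (s≤s (subst (1 ≤_) (sym (length-∷ʳ st a)) (s≤s z≤n))))
        | pops-all-above st a above x<a = refl

-- Reading k pops everything but the bottom a; then c₁ and k stay, and the same happens for k-1.
steps-comb : (k : ℕ) (cs st out : List ℕ) (a : ℕ) → All (k <_) st → All (k <_) cs → length cs ≡ k → k < a →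
  flush (steps (comb k cs) (st ++ [ a ] , out)) ≡ out ++ st ++ comb′ k (cs ++ [ a ])
steps-comb zero [] st out a _ _ _ _ = refl
steps-comb (suc k) (c ∷ cs) st out a above (k<c ∷ above-cs) len k<a
  rewrite pops-all-above st a above k<a
        | pops-pushable c (suc k ∷ [ a ]) (pushable-∷-below [ a ] (<⇒≤ k<c) (pushable-[ a ] c)) = begin
  flush (steps (comb k cs) ((c ∷ [ suc k ]) ++ [ a ] , (out ++ st) ++ []))
    ≡⟨ steps-comb k cs (c ∷ [ suc k ]) ((out ++ st) ++ []) a (<⇒≤ k<c ∷ ≤-refl ∷ [])
         (All.map <⇒≤ above-cs) (suc-injective len) (<⇒≤ k<a) ⟩
  ((out ++ st) ++ []) ++ c ∷ suc k ∷ comb′ k (cs ++ [ a ])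
    ≡⟨ cong₂ (λ o t → o ++ c ∷ t) (++-identityʳ (out ++ st)) (sym (comb-∷ʳ k cs a)) ⟩
  (out ++ st) ++ c ∷ comb (suc k) (cs ++ [ a ])
    ≡⟨ ++-assoc out st _ ⟩
  out ++ st ++ comb′ (suc k) ((c ∷ cs) ++ [ a ]) ∎
  where open ≡-Reasoning

s-via-steps : (a : ℕ) (α ys : List ℕ) → s ((a ∷ α) ++ ys) ≡ flush (steps ys (steps α ([ a ] , [])))
s-via-steps a α ys = trans (s≡flush-steps ((a ∷ α) ++ ys)) (cong flush (steps-++ (a ∷ α) ys ([] , [])))

stack-All : {P : ℕ → Set} (xs st out : List ℕ) → All P (out ++ st ++ xs) → All P (proj₁ (steps xs (st , out)))
stack-All xs st out h = ++⁻ʳ _ (All-resp-↭ (↭-sym (steps-↭ xs st out)) h)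

s-All : {P : ℕ → Set} {π : List ℕ} → All P π → All P (s π)
s-All h = All-resp-↭ (↭-sym (s-↭ _)) h

s-∷≡-All : {P : ℕ → Set} {a : ℕ} {α X : List ℕ} → s (a ∷ α) ≡ X ++ [ a ] → All P (a ∷ α) → All P X
s-∷≡-All {P} {X = X} s∷≡ h = ++⁻ˡ X (subst (All P) s∷≡ (s-All h))

first-stays-at-bottom : (a : ℕ) (α : List ℕ) →
  Σ (List ℕ) λ st → steps α ([ a ] , []) ≡ (st ++ [ a ] , proj₂ (steps α ([ a ] , [])))
first-stays-at-bottom a α with steps-keeps-suffix α [ a ] (All.universal (pushable-[ a ]) α) [] []
... | st , e = st , cong (_, proj₂ (steps α ([ a ] , []))) e

-- s acts on the prefix as if alone, while the comb rotates: its first tooth joins the prefix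
-- and the head a of the prefix becomes its last tooth.
s-prefix++comb : (k a : ℕ) (α cs : List ℕ) → All (k <_) (a ∷ α) → All (k <_) cs → length cs ≡ k →
  Σ (List ℕ) λ X → (s (a ∷ α) ≡ X ++ [ a ]) × (s ((a ∷ α) ++ comb k cs) ≡ X ++ comb′ k (cs ++ [ a ]))
s-prefix++comb k a α cs above above-cs len with first-stays-at-bottom a α
... | st , e = out ++ st , s≡ , s++comb≡
  where
  out = proj₂ (steps α ([ a ] , []))
  above-st : All (k <_) st
  above-st = ++⁻ˡ st (subst (λ σ → All (k <_) (proj₁ σ)) e (stack-All α [ a ] [] above))
  s≡ : s (a ∷ α) ≡ (out ++ st) ++ [ a ]
  s≡ = trans (s≡flush-steps (a ∷ α)) (trans (cong flush e) (sym (++-assoc out st [ a ])))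
  s++comb≡ : s ((a ∷ α) ++ comb k cs) ≡ (out ++ st) ++ comb′ k (cs ++ [ a ])
  s++comb≡ = begin
    s ((a ∷ α) ++ comb k cs)                          ≡⟨ s-via-steps a α (comb k cs) ⟩
    flush (steps (comb k cs) (steps α ([ a ] , [])))  ≡⟨ cong (λ σ → flush (steps (comb k cs) σ)) e ⟩
    flush (steps (comb k cs) (st ++ [ a ] , out))     ≡⟨ steps-comb k cs st out a above-st above-cs len (All.head above) ⟩
    out ++ st ++ comb′ k (cs ++ [ a ])                ≡⟨ sym (++-assoc out st _) ⟩
    (out ++ st) ++ comb′ k (cs ++ [ a ])              ∎
    where open ≡-Reasoning

-- Once the small entry b arrives, b and the first entry a form the bottom of the stack for good.
s-absorbs : {b a : ℕ} (β γ : List ℕ) → b < a → All (b <_) β → All (b <_) γ →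
  Σ (List ℕ) λ X → s (a ∷ β ++ b ∷ γ) ≡ X ++ b ∷ [ a ]
s-absorbs {b} {a} β γ b<a above-β above-γ with first-stays-at-bottom a β
... | st , e with steps-keeps-suffix γ (b ∷ [ a ]) bottom [] (out ++ st)
  where
  out = proj₂ (steps β ([ a ] , []))
  bottom : All (Pushable (b ∷ [ a ])) γ
  bottom = All.map (λ b<x → pushable-∷-below [ a ] (<⇒≤ b<x) (pushable-[ a ] _)) above-γ
... | st′ , e′ = proj₂ σ′ ++ st′ , (begin
  s ((a ∷ β) ++ b ∷ γ)                                ≡⟨ s-via-steps a β (b ∷ γ) ⟩
  flush (steps γ (step b (steps β ([ a ] , []))))     ≡⟨ cong (λ σ → flush (steps γ (step b σ))) e ⟩
  flush (steps γ (step b (st ++ [ a ] , out)))        ≡⟨ cong (λ p → flush (steps γ (b ∷ proj₂ p , out ++ proj₁ p)))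
                                                           (pops-all-above st a above-st b<a) ⟩
  flush σ′                                            ≡⟨ cong (proj₂ σ′ ++_) e′ ⟩
  proj₂ σ′ ++ st′ ++ b ∷ [ a ]                        ≡⟨ sym (++-assoc (proj₂ σ′) st′ _) ⟩
  (proj₂ σ′ ++ st′) ++ b ∷ [ a ]                      ∎)
  where
  open ≡-Reasoning
  out = proj₂ (steps β ([ a ] , []))
  σ′ = steps γ (b ∷ [ a ] , out ++ st)
  above-st : All (b <_) st
  above-st = ++⁻ˡ st (subst (λ σ → All (b <_) (proj₁ σ)) e (stack-All β [ a ] [] (b<a ∷ above-β)))

-- The shape after 2k steps

SmallNearEnd : ℕ → List ℕ → Set
SmallNearEnd j ρ = ∀ u → 1 ≤ u → u ≤ j → u ∈ ρ → WithinLast (2 * u) u ρ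

SmallNearEnd-s : {n j : ℕ} {ρ : List ℕ} → InS n ρ → SmallNearEnd j ρ → SmallNearEnd (suc j) (s ρ)
SmallNearEnd-s {ρ = ρ} p near (suc w) _ (s≤s w≤j) v∈sρ with ∈-∃++ (∈-resp-↭ (s-↭ ρ) v∈sρ)
... | P , S , refl = s-WithinLast P S w (InS-unique p) near′
  where
  near′ : ∀ u → u ≤ w → u ∈ P ++ suc w ∷ S → WithinLast (2 * u) u (P ++ suc w ∷ S)
  near′ u u≤w u∈ = near u (All.lookup (InS-positive p) u∈) (≤-trans u≤w w≤j) u∈

head-large : {n j a : ℕ} {α : List ℕ} → InS n (a ∷ α) → SmallNearEnd j (a ∷ α) → (j < a) ⊎ (n ≤ 2 * a)
head-large {n} {j} {a} p near with j <? a
... | yes j<a = inj₁ j<a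
... | no j≮a = inj₂ (subst (_≤ 2 * a) (InS-length p)
                       (WithinLast-unique [] (InS-unique p) refl
                         (near a (All.head (InS-positive p)) (≮⇒≥ j≮a) (here refl))))

-- A tooth c followed by d - 1 further teeth entered the comb d steps ago as the head a of
-- the prefix, when (by head-large) j - d < a or n ≤ 2a.
LargeTeeth : ℕ → ℕ → List ℕ → Set
LargeTeeth n j [] = ⊤
LargeTeeth n j (c ∷ cs) = ((j < c + suc (length cs)) ⊎ (n ≤ 2 * c)) × LargeTeeth n j cs

LargeTeeth-∷ʳ : {n j a : ℕ} (cs : List ℕ) → LargeTeeth n j cs → (j < a) ⊎ (n ≤ 2 * a) →
  LargeTeeth n (suc j) (cs ++ [ a ])
LargeTeeth-∷ʳ {j = j} {a} [] _ (inj₁ j<a) = inj₁ (subst (suc j <_) (+-comm 1 a) (s≤s j<a)) , tt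
LargeTeeth-∷ʳ [] _ (inj₂ n≤2a) = inj₂ n≤2a , tt
LargeTeeth-∷ʳ {j = j} {a} (c ∷ cs) (inj₁ j<c+ , large) h =
  inj₁ (subst (λ z → suc j < c + suc z) (sym (length-∷ʳ cs a)) (subst (suc j <_) (sym (+-suc c _)) (s≤s j<c+)))
  , LargeTeeth-∷ʳ cs large h
LargeTeeth-∷ʳ (c ∷ cs) (inj₂ n≤2c , large) h = inj₂ n≤2c , LargeTeeth-∷ʳ cs large h

record CombShape (n j k : ℕ) (ρ : List ℕ) : Set where
  constructor comb-shape
  field
    first : ℕ
    prefix teeth : List ℕ
    shape : ρ ≡ (first ∷ prefix) ++ comb k teeth
    prefix-above : All (k <_) (first ∷ prefix)
    teeth-above : All (k <_) teeth
    teeth-length : length teeth ≡ k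
    teeth-large : LargeTeeth n j teeth

∷ʳ-as-∷ : (xs : List ℕ) (a : ℕ) → Σ ℕ λ d → Σ (List ℕ) λ r → xs ++ [ a ] ≡ d ∷ r
∷ʳ-as-∷ [] a = a , [] , refl
∷ʳ-as-∷ (x ∷ xs) a = x , xs ++ [ a ] , refl

CombShape-s : {n j k : ℕ} {ρ : List ℕ} → InS n ρ → SmallNearEnd j ρ → CombShape n j k ρ →
  CombShape n (suc j) k (s ρ)
CombShape-s {n} {j} {k} p near (comb-shape a α cs refl above above-cs len large)
  with s-prefix++comb k a α cs above above-cs len | ∷ʳ-as-∷ cs a
... | X , s∷≡ , s≡ | d , r , cs∷ʳa≡ with ∷ʳ-as-∷ X d
... | a′ , α′ , X∷ʳd≡ =
  comb-shape a′ α′ r shape′ (subst (All (k <_)) X∷ʳd≡ (++⁺ (s-∷≡-All s∷≡ above) (All.head above-dr ∷ [])))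
             (All.tail above-dr) r-length (proj₂ large-dr)
  where
  above-dr : All (k <_) (d ∷ r)
  above-dr = subst (All (k <_)) cs∷ʳa≡ (++⁺ above-cs (All.head above ∷ []))
  r-length : length r ≡ k
  r-length = suc-injective (trans (cong length (sym cs∷ʳa≡)) (trans (length-∷ʳ cs a) (cong suc len)))
  large-dr : LargeTeeth n (suc j) (d ∷ r)
  large-dr = subst (LargeTeeth n (suc j)) cs∷ʳa≡ (LargeTeeth-∷ʳ cs large (head-large p near))
  shape′ : s ((a ∷ α) ++ comb k cs) ≡ (a′ ∷ α′) ++ comb k r
  shape′ = begin
    s ((a ∷ α) ++ comb k cs)        ≡⟨ s≡ ⟩
    X ++ comb′ k (cs ++ [ a ])      ≡⟨ cong (λ z → X ++ comb′ k z) cs∷ʳa≡ ⟩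
    X ++ d ∷ comb k r               ≡⟨ sym (++-assoc X [ d ] (comb k r)) ⟩
    (X ++ [ d ]) ++ comb k r        ≡⟨ cong (_++ comb k r) X∷ʳd≡ ⟩
    (a′ ∷ α′) ++ comb k r           ∎
    where open ≡-Reasoning

-- When the entry k + 1 sits in the prefix, it sinks to the bottom of the stack with the head a
-- (s-absorbs), so both end the prefix part of s ρ and become the new comb's first teeth.
s-grows-comb : {k a : ℕ} (β γ cs : List ℕ) → suc k < a → All (suc k <_) (β ++ γ) → All (suc k <_) cs →
  length cs ≡ k →
  Σ (List ℕ) λ X → (s ((a ∷ β ++ suc k ∷ γ) ++ comb k cs) ≡ X ++ comb (suc k) (cs ++ [ a ])) × (X ↭ β ++ γ)
s-grows-comb {k} {a} β γ cs k<a above-βγ above-cs len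
  with s-absorbs β γ k<a (++⁻ˡ β above-βγ) (++⁻ʳ β above-βγ)
     | s-prefix++comb k a (β ++ suc k ∷ γ) cs above (All.map <⇒≤ above-cs) len
  where
  above : All (k <_) (a ∷ β ++ suc k ∷ γ)
  above = <⇒≤ k<a ∷ ++⁺ (All.map <⇒≤ (++⁻ˡ β above-βγ)) (≤-refl ∷ All.map <⇒≤ (++⁻ʳ β above-βγ))
... | Y , s∷≡Y | X , s∷≡X , s≡ = Y , shape , Y↭
  where
  X≡ : X ≡ Y ++ [ suc k ]
  X≡ = ∷ʳ-injectiveˡ X (Y ++ [ suc k ]) (trans (sym s∷≡X) (trans s∷≡Y (sym (++-assoc Y [ suc k ] [ a ]))))
  shape : s ((a ∷ β ++ suc k ∷ γ) ++ comb k cs) ≡ Y ++ comb (suc k) (cs ++ [ a ])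
  shape = trans s≡ (trans (cong (_++ comb′ k (cs ++ [ a ])) X≡)
                  (trans (++-assoc Y [ suc k ] _) (cong (Y ++_) (sym (comb-∷ʳ k cs a)))))
  Y↭ : Y ↭ β ++ γ
  Y↭ = ↭.drop-∷ (↭-trans (↭.∷↭∷ʳ a Y)
         (↭.drop-mid Y (a ∷ β) (subst (_↭ a ∷ β ++ suc k ∷ γ) s∷≡Y (s-↭ (a ∷ β ++ suc k ∷ γ)))))

large⇒above : {n k c d : ℕ} → 3 + 2 * k ≤ n → d ≤ k → (1 + 2 * k < c + d) ⊎ (n ≤ 2 * c) → suc k < c
large⇒above {n} {k} {c} {d} _ d≤k (inj₁ lt) = +-cancelʳ-< k (suc k) c (begin-strict
  suc k + k      ≡⟨ solve 1 (λ k → (con 1 :+ k) :+ k := con 1 :+ con 2 :* k) refl k ⟩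
  1 + 2 * k      <⟨ lt ⟩
  c + d          ≤⟨ +-monoʳ-≤ c d≤k ⟩
  c + k          ∎)
  where open ≤-Reasoning
large⇒above {n} {k} {c} n≥ _ (inj₂ n≤2c) = *-cancelˡ-< 2 (suc k) c (begin-strict
  2 * suc k      ≡⟨ *-suc 2 k ⟩
  2 + 2 * k      <⟨ n≥ ⟩
  n              ≤⟨ n≤2c ⟩
  2 * c          ∎)
  where open ≤-Reasoning

LargeTeeth-above : {n k : ℕ} (cs : List ℕ) → 3 + 2 * k ≤ n → LargeTeeth n (1 + 2 * k) cs → length cs ≤ k →
  All (suc k <_) cs
LargeTeeth-above [] _ _ _ = []
LargeTeeth-above (c ∷ cs) n≥ (h , large) len = large⇒above n≥ len h ∷ LargeTeeth-above cs n≥ large (<⇒≤ len)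

above-suc : {k : ℕ} (xs : List ℕ) → All (k <_) xs → suc k ∉ xs → All (suc k <_) xs
above-suc xs above k+1∉ = tabulate λ {x} x∈ →
  ≤∧≢⇒< (All.lookup above x∈) (λ k+1≡x → k+1∉ (subst (_∈ xs) (sym k+1≡x) x∈))

-- The entry k + 1 is in the prefix, since it exceeds all entries of comb k that are at most k.
next-tooth-in-prefix : {n k a : ℕ} {α cs : List ℕ} → InS n ((a ∷ α) ++ comb k cs) → suc k ≤ n →
  suc k < a → All (suc k <_) cs → suc k ∈ α
next-tooth-in-prefix {n} {k} {a} {α} {cs} p k<n k<a above-cs
  with ∈-++⁻ (a ∷ α) (∈-resp-↭ (↭-sym p) (∈-oneTo⁺ (s≤s z≤n) k<n))
... | inj₁ (here refl) = ⊥-elim (<-irrefl refl k<a)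
... | inj₁ (there k+1∈α) = k+1∈α
... | inj₂ k+1∈comb with ∈-comb k cs k+1∈comb
... | inj₁ k+1≤k = ⊥-elim (<-irrefl refl k+1≤k)
... | inj₂ k+1∈cs = ⊥-elim (<-irrefl refl (All.lookup above-cs k+1∈cs))

length-comb-shape : (a b : ℕ) (β γ cs : List ℕ) {k : ℕ} → length cs ≡ k →
  length ((a ∷ β ++ b ∷ γ) ++ comb k cs) ≡ 2 + length (β ++ γ) + 2 * k
length-comb-shape a b β γ cs {k} len = begin
  length ((a ∷ β ++ b ∷ γ) ++ comb k cs)          ≡⟨ length-++ (a ∷ β ++ b ∷ γ) ⟩
  suc (length (β ++ b ∷ γ)) + length (comb k cs)  ≡⟨ cong₂ (λ x y → suc x + y) (length-++ β) (length-comb k cs len) ⟩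
  suc (length β + suc (length γ)) + (k + k)       ≡⟨ solve 3 (λ x y k → (con 1 :+ (x :+ (con 1 :+ y))) :+ (k :+ k)
                                                                  := con 2 :+ (x :+ y) :+ con 2 :* k) refl
                                                       (length β) (length γ) k ⟩
  2 + (length β + length γ) + 2 * k               ≡⟨ cong (λ z → 2 + z + 2 * k) (sym (length-++ β)) ⟩
  2 + length (β ++ γ) + 2 * k                     ∎
  where open ≡-Reasoning

CombShape-grow-at : {n k a : ℕ} {α cs : List ℕ} → 3 + 2 * k ≤ n → InS n ((a ∷ α) ++ comb k cs) →
  suc k < a → All (k <_) α → All (suc k <_) cs → length cs ≡ k → LargeTeeth n (2 + 2 * k) (cs ++ [ a ]) →
  (Σ (List ℕ) λ β → Σ (List ℕ) λ γ → α ≡ β ++ [ suc k ] ++ γ) →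
  CombShape n (2 + 2 * k) (suc k) (s ((a ∷ α) ++ comb k cs))
CombShape-grow-at {n} {k} {a} {cs = cs} n≥ p k<a above-α above-cs len large (β , γ , refl) =
  build (s-grows-comb β γ cs k<a βγ-above above-cs len)
  where
  un : Unique ((a ∷ β) ++ suc k ∷ γ)
  un = unique-++ˡ (a ∷ β ++ suc k ∷ γ) (InS-unique p)
  βγ-above : All (suc k <_) (β ++ γ)
  βγ-above = ++⁺ (above-suc β (++⁻ˡ β above-α) (λ k+1∈β → unique-∉-prefix (a ∷ β) un (there k+1∈β)))
                 (above-suc γ (All.tail (++⁻ʳ β above-α)) (unique-∉-suffix (a ∷ β) un))
  build : (Σ (List ℕ) λ X → (s ((a ∷ β ++ suc k ∷ γ) ++ comb k cs) ≡ X ++ comb (suc k) (cs ++ [ a ])) × (X ↭ β ++ γ)) →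
    CombShape n (2 + 2 * k) (suc k) (s ((a ∷ β ++ suc k ∷ γ) ++ comb k cs))
  build ([] , _ , X↭) = ⊥-elim (1+n≰n (subst (3 + 2 * k ≤_) n≡ n≥))
    where
    n≡ : n ≡ 2 + 2 * k
    n≡ = trans (sym (InS-length p))
           (trans (length-comb-shape a (suc k) β γ cs len) (cong (λ z → 2 + z + 2 * k) (sym (↭.↭-length X↭))))
  build (a′ ∷ α′ , shape , X↭) =
    comb-shape a′ α′ (cs ++ [ a ]) shape (All-resp-↭ (↭-sym X↭) βγ-above)
               (++⁺ above-cs (k<a ∷ [])) (trans (length-∷ʳ cs a) (cong suc len)) large

CombShape-s-grow : {n k : ℕ} {ρ : List ℕ} → 3 + 2 * k ≤ n → InS n ρ → SmallNearEnd (1 + 2 * k) ρ →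
  CombShape n (1 + 2 * k) k ρ → CombShape n (2 + 2 * k) (suc k) (s ρ)
CombShape-s-grow {n} {k} n≥ p near (comb-shape a α cs refl above above-cs len large) =
  CombShape-grow-at n≥ p a-above (All.tail above) cs-above len (LargeTeeth-∷ʳ cs large (head-large p near))
    (∈-∃++ (next-tooth-in-prefix p k<n a-above cs-above))
  where
  a-above : suc k < a
  a-above = large⇒above n≥ z≤n (Sum.map₁ (subst (1 + 2 * k <_) (sym (+-identityʳ a))) (head-large p near))
  cs-above : All (suc k <_) cs
  cs-above = LargeTeeth-above cs n≥ large (≤-reflexive len)
  k<n : suc k ≤ n
  k<n = ≤-trans (s≤s (m≤m+n k (k + 0))) (≤-trans (n≤1+n _) (<⇒≤ n≥))

iter-+ : (i j : ℕ) (f : List ℕ → List ℕ) (x : List ℕ) → iter (i + j) f x ≡ iter i f (iter j f x)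
iter-+ zero j f x = refl
iter-+ (suc i) j f x = cong f (iter-+ i j f x)

iter-suc : (i : ℕ) (f : List ℕ → List ℕ) (x : List ℕ) → iter (suc i) f x ≡ iter i f (f x)
iter-suc i f x = trans (cong (λ m → iter m f x) (+-comm 1 i)) (iter-+ i 1 f x)

InS-iter : {n : ℕ} {π : List ℕ} → InS n π → (i : ℕ) → InS n (iter i s π)
InS-iter p zero = p
InS-iter p (suc i) = InS-s (InS-iter p i)

after-2k-steps : {n : ℕ} {π : List ℕ} → InS n π → (k : ℕ) → 1 + 2 * k ≤ n →
  CombShape n (2 * k) k (iter (2 * k) s π) × SmallNearEnd (2 * k) (iter (2 * k) s π)
after-2k-steps {π = []} p zero n≥ = ⊥-elim (1+n≰n (subst (1 ≤_) (sym (InS-length p)) n≥))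
after-2k-steps {π = a ∷ α} p zero _ =
  comb-shape a α [] (sym (++-identityʳ (a ∷ α))) (InS-positive p) [] refl tt ,
  λ u 1≤u u≤0 _ → ⊥-elim (<⇒≱ 1≤u u≤0)
after-2k-steps {n} {π = π} p (suc k) n≥ =
  subst (λ j → CombShape n j (suc k) (iter j s π) × SmallNearEnd j (iter j s π)) (sym (*-suc 2 k))
    (CombShape-s-grow n≥′ (InS-s pρ) (SmallNearEnd-s pρ near) (CombShape-s pρ near shape) ,
     SmallNearEnd-s (InS-s pρ) (SmallNearEnd-s pρ near))
  where
  n≥′ : 3 + 2 * k ≤ n
  n≥′ = subst (λ z → 1 + z ≤ n) (*-suc 2 k) n≥
  pρ = InS-iter p (2 * k)
  IH = after-2k-steps p k (≤-trans (s≤s (*-monoʳ-≤ 2 (n≤1+n k))) n≥)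
  shape = proj₁ IH
  near = proj₂ IH

-- Periodicity

rotate : List ℕ → List ℕ
rotate [] = []
rotate (x ∷ xs) = xs ++ [ x ]

rotateN : ℕ → List ℕ → List ℕ
rotateN zero xs = xs
rotateN (suc i) xs = rotateN i (rotate xs)

rotateN-++ : (xs ys : List ℕ) → rotateN (length xs) (xs ++ ys) ≡ ys ++ xs
rotateN-++ [] ys = sym (++-identityʳ ys)
rotateN-++ (x ∷ xs) ys = trans (cong (rotateN (length xs)) (++-assoc xs ys [ x ]))
                         (trans (rotateN-++ xs (ys ++ [ x ])) (++-assoc ys [ x ] xs))

periodic-conjugate : (f : List ℕ → List ℕ) (P : List ℕ → Set) → (∀ L → P L → P (rotate L)) →
  (∀ L → P L → s (f L) ≡ f (rotate L)) → ∀ L → P L → 1 ≤ length L → Periodic (f L)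
periodic-conjugate f P P-rotate s-f L PL 1≤ =
  length L , 1≤ , trans (iter-s-f (length L) L PL)
                    (cong f (trans (cong (rotateN (length L)) (sym (++-identityʳ L))) (rotateN-++ L [])))
  where
  iter-s-f : ∀ i L → P L → iter i s (f L) ≡ f (rotateN i L)
  iter-s-f zero L PL = refl
  iter-s-f (suc i) L PL = trans (iter-suc i s (f L))
    (trans (cong (iter i s) (s-f L PL)) (iter-s-f i (rotate L) (P-rotate L PL)))

WheelOf : ℕ → ℕ → List ℕ → Set
WheelOf m e L = All (m <_) L × (length L ≡ e)

WheelOf-rotate : {m e : ℕ} → ∀ L → WheelOf m e L → WheelOf m e (rotate L)
WheelOf-rotate [] w = w
WheelOf-rotate (x ∷ xs) (x> ∷ xs> , len) = ++⁺ xs> (x> ∷ []) , trans (length-∷ʳ xs x) len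

wheel₂ : ℕ → List ℕ → List ℕ
wheel₂ m [] = []
wheel₂ m (a ∷ L) = a ∷ comb′ m L

s-comb′ : (m : ℕ) → ∀ L → WheelOf m (suc m) L → s (comb′ m L) ≡ comb′ m (rotate L)
s-comb′ m (a ∷ cs) (a> ∷ cs> , len) with s-prefix++comb m a [] cs (a> ∷ []) cs> (suc-injective len)
... | X , s∷≡ , s≡ = trans s≡ (cong (_++ comb′ m (cs ++ [ a ])) (∷ʳ-injectiveˡ X [] (sym s∷≡)))

s-wheel₂ : (m : ℕ) → ∀ L → WheelOf m (suc (suc m)) L → s (wheel₂ m L) ≡ wheel₂ m (rotate L)
s-wheel₂ m (a ∷ b ∷ cs) (a> ∷ b> ∷ cs> , len)
  with s-prefix++comb m a [ b ] cs (a> ∷ b> ∷ []) cs> (suc-injective (suc-injective len))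
... | X , s∷≡ , s≡ = trans s≡ (cong (_++ comb′ m (cs ++ [ a ])) (∷ʳ-injectiveˡ X [ b ] (trans (sym s∷≡) s-pair)))
  where
  s-pair : s (a ∷ [ b ]) ≡ b ∷ [ a ]
  s-pair = trans (s≡flush-steps (a ∷ [ b ]))
             (cong (λ p → ([] ++ proj₁ p) ++ b ∷ proj₂ p) (pops-pushable b [ a ] (pushable-[ a ] b)))

CombShape-periodic : {n j m : ℕ} {ρ : List ℕ} → CombShape n j m ρ → length ρ ≡ n → n ≤ 2 + 2 * m → Periodic ρ
CombShape-periodic {m = m} (comb-shape a [] cs refl a> cs> len _) _ _ =
  periodic-conjugate (comb′ m) (WheelOf m (suc m)) WheelOf-rotate (s-comb′ m) (a ∷ cs)
    (All.head a> ∷ cs> , cong suc len) (s≤s z≤n)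
CombShape-periodic {m = m} (comb-shape a (b ∷ []) cs refl (a> ∷ b> ∷ []) cs> len _) _ _ =
  periodic-conjugate (wheel₂ m) (WheelOf m (suc (suc m))) WheelOf-rotate (s-wheel₂ m) (a ∷ b ∷ cs)
    (a> ∷ b> ∷ cs> , cong (λ z → suc (suc z)) len) (s≤s z≤n)
CombShape-periodic {n} {m = m} (comb-shape a (b ∷ c ∷ α) cs refl _ _ len _) |ρ|≡n n≤ =
  ⊥-elim (<⇒≱ (subst (2 + 2 * m <_) |ρ|≡n too-long) n≤)
  where
  too-long : 2 + 2 * m < length ((a ∷ b ∷ c ∷ α) ++ comb m cs)
  too-long = begin-strict
    2 + 2 * m                              <⟨ s≤s (s≤s (s≤s (m≤n+m (2 * m) (length α)))) ⟩
    3 + (length α + 2 * m)                 ≡⟨ cong (λ z → 3 + (length α + z)) (cong (m +_) (+-identityʳ m)) ⟩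
    length (a ∷ b ∷ c ∷ α) + (m + m)       ≡⟨ cong (length (a ∷ b ∷ c ∷ α) +_) (sym (length-comb m cs len)) ⟩
    length (a ∷ b ∷ c ∷ α) + length (comb m cs) ≡⟨ sym (length-++ (a ∷ b ∷ c ∷ α)) ⟩
    length ((a ∷ b ∷ c ∷ α) ++ comb m cs)  ∎
    where open ≤-Reasoning

upper-bound : {n k : ℕ} → 1 + 2 * k ≤ n → n ≤ 2 + 2 * k → AllPeriodicAfter n (2 * k)
upper-bound {k = k} n≥ n≤ π p =
  CombShape-periodic (proj₁ (after-2k-steps p k n≥)) (InS-length (InS-iter p (2 * k))) n≤

-- The lower-bound witness

countAbove-∷-below : {l y : ℕ} (bot : List ℕ) → l ≤ y → countAbove y (l ∷ bot) ≡ countAbove y bot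
countAbove-∷-below {l} {y} bot l≤y rewrite ≤⇒<ᵇ≡false l≤y = refl

countAbove-[_] : {y : ℕ} (d : ℕ) → y < d → countAbove y [ d ] ≡ 1
countAbove-[_] {y} d y<d rewrite <⇒<ᵇ≡true y<d = refl

-- Each entry of a descending run pops its predecessor and then sits on bot.
steps-descending : {bot : List ℕ} (t : ℕ) (Z : List ℕ) (l : ℕ) (out : List ℕ) → Linked _>_ (t ∷ Z ++ [ l ]) →
  All (λ y → countAbove y bot ≡ 1) (Z ++ [ l ]) → steps (Z ++ [ l ]) (t ∷ bot , out) ≡ (l ∷ bot , out ++ t ∷ Z)
steps-descending {bot} t [] l out (l<t ∷ _) (one ∷ [])
  rewrite <⇒<ᵇ≡true l<t | one | pops-pushable l bot (cong (_<ᵇ 2) one) = refl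
steps-descending {bot} t (z ∷ Z) l out (z<t ∷ desc) (one ∷ ones)
  rewrite <⇒<ᵇ≡true z<t | one | pops-pushable z bot (cong (_<ᵇ 2) one) =
  trans (steps-descending z Z l (out ++ [ t ]) desc ones) (cong (l ∷ bot ,_) (++-assoc out [ t ] (z ∷ Z)))

steps-descending-onto : {bot : List ℕ} (Z : List ℕ) (l : ℕ) (out : List ℕ) → Linked _>_ (Z ++ [ l ]) →
  All (λ y → countAbove y bot ≡ 1) (Z ++ [ l ]) → steps (Z ++ [ l ]) (bot , out) ≡ (l ∷ bot , out ++ Z)
steps-descending-onto {bot} [] l out _ (one ∷ [])
  rewrite pops-pushable l bot (cong (_<ᵇ 2) one) = refl
steps-descending-onto {bot} (t ∷ Z) l out desc (one ∷ ones)
  rewrite pops-pushable t bot (cong (_<ᵇ 2) one) | ++-identityʳ out = steps-descending t Z l out desc ones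

flush-steps-descending : {bot : List ℕ} (E out : List ℕ) → Linked _>_ E → All (λ y → countAbove y bot ≡ 1) E →
  flush (steps E (bot , out)) ≡ out ++ E ++ bot
flush-steps-descending {bot} E out desc ones with initLast E
... | [] = refl
... | Z ∷ʳ′ l = trans (cong flush (steps-descending-onto Z l out desc ones))
                 (trans (++-assoc out Z (l ∷ bot)) (cong (out ++_) (sym (++-assoc Z [ l ] bot))))

-- The first run leaves its last entry l on d, and the second run passes over both.
s-two-runs : {d l : ℕ} (Z E : List ℕ) → Linked _>_ (Z ++ [ l ]) → All (_< d) (Z ++ [ l ]) →
  Linked _>_ E → All (λ y → l < y × y < d) E → s (d ∷ (Z ++ [ l ]) ++ E) ≡ Z ++ E ++ l ∷ [ d ]
s-two-runs {d} {l} Z E desc below desc′ between = begin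
  s (d ∷ (Z ++ [ l ]) ++ E)
    ≡⟨ trans (s≡flush-steps (d ∷ (Z ++ [ l ]) ++ E)) (cong flush (steps-++ (d ∷ Z ++ [ l ]) E ([] , []))) ⟩
  flush (steps E (steps (Z ++ [ l ]) ([ d ] , [])))
    ≡⟨ cong (λ σ → flush (steps E σ)) (steps-descending-onto Z l [] desc (All.map (countAbove-[ d ]) below)) ⟩
  flush (steps E (l ∷ [ d ] , Z))
    ≡⟨ flush-steps-descending E Z desc′
         (All.map (λ (l<y , y<d) → trans (countAbove-∷-below [ d ] (<⇒≤ l<y)) (countAbove-[ d ] y<d)) between) ⟩
  Z ++ E ++ l ∷ [ d ] ∎
  where open ≡-Reasoning

desc : ℕ → ℕ → List ℕ
desc lo = applyDownFrom (lo +_)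

desc-∷ʳ : (lo l : ℕ) → desc lo (suc l) ≡ desc (suc lo) l ++ [ lo ]
desc-∷ʳ lo zero = cong [_] (+-identityʳ lo)
desc-∷ʳ lo (suc l) = cong₂ _∷_ (+-suc lo l) (desc-∷ʳ lo l)

∈-desc⁻ : {lo l x : ℕ} → x ∈ desc lo l → lo ≤ x × x < lo + l
∈-desc⁻ {lo} {suc l} (here refl) = m≤m+n lo l , +-monoʳ-< lo ≤-refl
∈-desc⁻ {lo} {suc l} (there x∈) = Product.map₂ (λ x< → <-trans x< (+-monoʳ-< lo ≤-refl)) (∈-desc⁻ x∈)

desc-All : {P : ℕ → Set} (lo l : ℕ) → (∀ {x} → lo ≤ x → x < lo + l → P x) → All P (desc lo l)
desc-All lo l h = tabulate λ x∈ → uncurry h (∈-desc⁻ x∈)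

desc-descending : (lo l : ℕ) → Linked _>_ (desc lo l)
desc-descending lo l = LinkedP.applyDownFrom⁺₂ (lo +_) l (λ i → +-monoʳ-< lo ≤-refl)

Linked->-++ : {b : ℕ} (xs ys : List ℕ) → All (b ≤_) xs → All (_< b) ys → Linked _>_ xs → Linked _>_ ys →
  Linked _>_ (xs ++ ys)
Linked->-++ [] ys _ _ _ desc-ys = desc-ys
Linked->-++ (x ∷ []) [] _ _ _ _ = [-]
Linked->-++ (x ∷ []) (y ∷ ys) (b≤x ∷ []) (y<b ∷ _) _ desc-ys = <-≤-trans y<b b≤x ∷ desc-ys
Linked->-++ (x ∷ x′ ∷ xs) ys (_ ∷ above) below (x′<x ∷ desc-xs) desc-ys =
  x′<x ∷ Linked->-++ (x′ ∷ xs) ys above below desc-xs desc-ys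

-- The tooth x moves one place forward per step until it leaves the comb and ends the prefix.
tooth-travels : {k a x : ℕ} (α ds es : List ℕ) → length (ds ++ x ∷ es) ≡ k →
  All (k <_) (a ∷ α) → All (k <_) (ds ++ x ∷ es) →
  Σ (List ℕ) λ β → Σ (List ℕ) λ ds′ →
    (iter (suc (length ds)) s ((a ∷ α) ++ comb k (ds ++ x ∷ es)) ≡ β ++ x ∷ comb k ds′) × (length ds′ ≡ k)
tooth-travels {k} {a} {x} α [] es len above above-cs with s-prefix++comb k a α (x ∷ es) above above-cs len
... | X , _ , s≡ = X , es ++ [ a ] , s≡ , trans (length-∷ʳ es a) len
tooth-travels {k} {a} {x} α (d ∷ ds) es len above above-cs
  with s-prefix++comb k a α (d ∷ ds ++ x ∷ es) above above-cs len
... | X , s∷≡ , s≡ with ∷ʳ-as-∷ X d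
... | a′ , α′ , X∷ʳd≡
  with tooth-travels {a = a′} α′ ds (es ++ [ a ]) len′
         (subst (All (k <_)) X∷ʳd≡ (++⁺ (s-∷≡-All s∷≡ above) (All.head above-cs ∷ [])))
         (subst (All (k <_)) (++-assoc ds (x ∷ es) [ a ]) (++⁺ (All.tail above-cs) (All.head above ∷ [])))
  where
  len′ : length (ds ++ x ∷ es ++ [ a ]) ≡ k
  len′ = trans (cong length (sym (++-assoc ds (x ∷ es) [ a ]))) (trans (length-∷ʳ (ds ++ x ∷ es) a) len)
... | β , ds′ , iter≡ , len-ds′ =
  β , ds′ , trans (iter-suc (suc (length ds)) s _) (trans (cong (iter (suc (length ds)) s) s-step) iter≡) , len-ds′
  where
  s-step : s ((a ∷ α) ++ comb k (d ∷ ds ++ x ∷ es)) ≡ (a′ ∷ α′) ++ comb k (ds ++ x ∷ es ++ [ a ])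
  s-step = trans s≡ (trans (cong (λ z → X ++ d ∷ comb k z) (++-assoc ds (x ∷ es) [ a ]))
             (trans (sym (++-assoc X [ d ] _)) (cong (_++ comb k (ds ++ x ∷ es ++ [ a ])) X∷ʳd≡)))

head-travels : {k x : ℕ} (α cs : List ℕ) → length cs ≡ k → All (k <_) (x ∷ α) → All (k <_) cs →
  Σ (List ℕ) λ β → Σ (List ℕ) λ ds →
    (iter (suc k) s ((x ∷ α) ++ comb k cs) ≡ β ++ x ∷ comb k ds) × (length ds ≡ k)
head-travels {zero} {x} α [] refl above [] with s-prefix++comb zero x α [] above [] refl
... | X , _ , s≡ = X , [] , s≡ , refl
head-travels {suc k} {x} α (c ∷ cs) len above above-cs with s-prefix++comb (suc k) x α (c ∷ cs) above above-cs len
... | X , s∷≡ , s≡ with ∷ʳ-as-∷ X c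
... | a′ , α′ , X∷ʳc≡
  with tooth-travels {a = a′} α′ cs [] (trans (length-∷ʳ cs x) len)
         (subst (All (suc k <_)) X∷ʳc≡ (++⁺ (s-∷≡-All s∷≡ above) (All.head above-cs ∷ [])))
         (++⁺ (All.tail above-cs) (All.head above ∷ []))
... | β , ds , iter≡ , len-ds =
  β , ds , trans (iter-suc (suc k) s _) (trans (cong (iter (suc k) s) s-step) iter≡′) , len-ds
  where
  iter≡′ : iter (suc k) s ((a′ ∷ α′) ++ comb (suc k) (cs ++ [ x ])) ≡ β ++ x ∷ comb (suc k) ds
  iter≡′ = subst (λ j → iter (suc j) s ((a′ ∷ α′) ++ comb (suc k) (cs ++ [ x ])) ≡ β ++ x ∷ comb (suc k) ds)
             (suc-injective len) iter≡
  s-step : s ((x ∷ α) ++ comb (suc k) (c ∷ cs)) ≡ (a′ ∷ α′) ++ comb (suc k) (cs ++ [ x ])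
  s-step = trans s≡ (trans (sym (++-assoc X [ c ] _)) (cong (_++ comb (suc k) (cs ++ [ x ])) X∷ʳc≡))

applyUpTo-++ : (f : ℕ → ℕ) (a b : ℕ) → applyUpTo f (a + b) ≡ applyUpTo f a ++ applyUpTo (λ i → f (a + i)) b
applyUpTo-++ f zero b = refl
applyUpTo-++ f (suc a) b = cong (f 0 ∷_) (applyUpTo-++ (λ i → f (suc i)) a b)

desc↭ : (lo l : ℕ) → desc lo l ↭ applyUpTo (lo +_) l
desc↭ lo l = subst (_↭ applyUpTo (lo +_) l) (reverse-applyUpTo (lo +_) l) (↭.↭-reverse (applyUpTo (lo +_) l))

-- The witness in S_n, n = 2k + 3 + e, is top block ++ low block ++ high block, each block
-- descending. For k steps the top block feeds the comb while the low block 1, …, k + 1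
-- releases its smallest entries as the small teeth k, …, 1.
module Witness (k e : ℕ) where

  top : ℕ
  top = suc (suc k + (2 + e))

  high : List ℕ
  high = desc (suc (suc k)) (2 + e)

  prefixAt : ℕ → ℕ → List ℕ
  prefixAt i r = desc top r ++ desc (suc i) (suc r) ++ high

  witness : List ℕ
  witness = prefixAt 0 k

  low<k+2 : {i r x : ℕ} → i + suc r ≡ k → x < suc i + suc (suc r) → x < 2 + k
  low<k+2 {i} {r} {x} i+r+1≡k x< =
    subst (x <_) (trans (solve 2 (λ i r → con 1 :+ i :+ (con 2 :+ r) := con 2 :+ (i :+ (con 1 :+ r))) refl i r)
                        (cong (2 +_) i+r+1≡k)) x<

  k+2≤top : 2 + k ≤ top
  k+2≤top = s≤s (s≤s (m≤m+n k (2 + e)))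

  first-run-descending : (i r : ℕ) → i + suc r ≡ k → Linked _>_ (desc top r ++ desc (suc i) (suc (suc r)))
  first-run-descending i r i+r+1≡k =
    Linked->-++ (desc top r) _ (desc-All top r (λ top≤ _ → top≤))
      (desc-All (suc i) (suc (suc r)) (λ _ x< → <-≤-trans (low<k+2 i+r+1≡k x<) k+2≤top))
      (desc-descending top r) (desc-descending (suc i) (suc (suc r)))

  first-run-below : (i r : ℕ) → i + suc r ≡ k → All (_< top + r) (desc top r ++ desc (suc i) (suc (suc r)))
  first-run-below i r i+r+1≡k =
    ++⁺ (desc-All top r (λ _ x< → x<))
        (desc-All (suc i) (suc (suc r)) (λ _ x< → <-≤-trans (low<k+2 i+r+1≡k x<) (≤-trans k+2≤top (m≤m+n top r))))

  high-between : (i r : ℕ) → i ≤ k → All (λ y → suc i < y × y < top + r) high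
  high-between i r i≤k =
    desc-All (2 + k) (2 + e) (λ k+2≤ y< → <-≤-trans (s≤s (s≤s i≤k)) k+2≤ , <-≤-trans y< (m≤m+n top r))

  s-prefixAt : (i r : ℕ) → i + suc r ≡ k →
    s (prefixAt i (suc r)) ≡ (prefixAt (suc i) r ++ [ suc i ]) ++ [ top + r ]
  s-prefixAt i r i+r+1≡k = begin
    s (top + r ∷ desc top r ++ desc (suc i) (suc (suc r)) ++ high)
      ≡⟨ cong (λ z → s (top + r ∷ z)) (sym (++-assoc (desc top r) _ high)) ⟩
    s (top + r ∷ (desc top r ++ desc (suc i) (suc (suc r))) ++ high)
      ≡⟨ cong (λ z → s (top + r ∷ z ++ high)) run≡ ⟩
    s (top + r ∷ (Z ++ [ suc i ]) ++ high)
      ≡⟨ s-two-runs Z high (subst (Linked _>_) run≡ (first-run-descending i r i+r+1≡k))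
           (subst (All (_< top + r)) run≡ (first-run-below i r i+r+1≡k)) (desc-descending (2 + k) (2 + e))
           (high-between i r (subst (i ≤_) i+r+1≡k (m≤m+n i (suc r)))) ⟩
    Z ++ high ++ suc i ∷ [ top + r ]
      ≡⟨ ++-assoc (desc top r) _ _ ⟩
    desc top r ++ desc (2 + i) (suc r) ++ high ++ suc i ∷ [ top + r ]
      ≡⟨ sym (trans (++-assoc (prefixAt (suc i) r) [ suc i ] [ top + r ])
                    (trans (++-assoc (desc top r) _ _) (cong (desc top r ++_) (++-assoc (desc (2 + i) (suc r)) high _)))) ⟩
    (prefixAt (suc i) r ++ [ suc i ]) ++ [ top + r ] ∎
    where
    open ≡-Reasoning
    Z = desc top r ++ desc (2 + i) (suc r)
    run≡ : desc top r ++ desc (suc i) (suc (suc r)) ≡ Z ++ [ suc i ]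
    run≡ = trans (cong (desc top r ++_) (desc-∷ʳ (suc i) (suc r))) (sym (++-assoc (desc top r) _ [ suc i ]))

  prefixAt-above : (i r : ℕ) → i + suc r ≡ k → All (i <_) (prefixAt i (suc r))
  prefixAt-above i r i+r+1≡k =
    ++⁺ (desc-All top (suc r) (λ top≤ _ → <-≤-trans i<top top≤))
        (++⁺ (desc-All (suc i) (suc (suc r)) (λ i< _ → i<))
             (desc-All (2 + k) (2 + e) (λ k+2≤ _ → <-≤-trans i<k+2 k+2≤)))
    where
    i<k+2 : i < 2 + k
    i<k+2 = s≤s (m≤n⇒m≤1+n (subst (i ≤_) i+r+1≡k (m≤m+n i (suc r))))
    i<top : i < top
    i<top = <-≤-trans i<k+2 (s≤s (s≤s (m≤m+n k (2 + e))))

  phase₁ : (i r : ℕ) → i + r ≡ k →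
    Σ (List ℕ) λ cs → (iter i s witness ≡ prefixAt i r ++ comb i cs) × (length cs ≡ i) × All (suc k <_) cs
  phase₁ zero r refl = [] , sym (++-identityʳ witness) , refl , []
  phase₁ (suc i) r i+r+1≡k with phase₁ i (suc r) (trans (+-suc i r) i+r+1≡k)
  ... | cs , iter≡ , len , cs-above
    with s-prefix++comb i (top + r) _ cs (prefixAt-above i r (trans (+-suc i r) i+r+1≡k))
           (All.map (λ k<c → <-≤-trans (s≤s (subst (i ≤_) i+r+1≡k (m≤n⇒m≤1+n (m≤m+n i r)))) (<⇒≤ k<c)) cs-above) len
  ... | X , s∷≡ , s≡ = cs ++ [ top + r ] , iter≡′ , trans (length-∷ʳ cs (top + r)) (cong suc len) ,
                       ++⁺ cs-above (<-≤-trans (s≤s (s≤s (m≤m+n k (2 + e)))) (m≤m+n top r) ∷ [])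
    where
    X≡ : X ≡ prefixAt (suc i) r ++ [ suc i ]
    X≡ = ∷ʳ-injectiveˡ X _ (trans (sym s∷≡) (s-prefixAt i r (trans (+-suc i r) i+r+1≡k)))
    iter≡′ : iter (suc i) s witness ≡ prefixAt (suc i) r ++ comb (suc i) (cs ++ [ top + r ])
    iter≡′ = begin
      s (iter i s witness)                                        ≡⟨ cong s iter≡ ⟩
      s (prefixAt i (suc r) ++ comb i cs)                         ≡⟨ s≡ ⟩
      X ++ comb′ i (cs ++ [ top + r ])                            ≡⟨ cong (_++ comb′ i (cs ++ [ top + r ])) X≡ ⟩
      (prefixAt (suc i) r ++ [ suc i ]) ++ comb′ i (cs ++ [ top + r ])
        ≡⟨ trans (++-assoc (prefixAt (suc i) r) [ suc i ] _) (cong (prefixAt (suc i) r ++_) (sym (comb-∷ʳ i cs (top + r)))) ⟩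
      prefixAt (suc i) r ++ comb (suc i) (cs ++ [ top + r ])      ∎
      where open ≡-Reasoning

  -- After phase₁ the entry k + 1 heads the prefix; it then travels through the comb.
  witness-after : Σ (List ℕ) λ β → Σ (List ℕ) λ ds →
    (iter (suc k + k) s witness ≡ β ++ suc k ∷ comb k ds) × (length ds ≡ k)
  witness-after with phase₁ k 0 (+-identityʳ k)
  ... | cs , iter≡ , len , cs-above
    with head-travels high cs len (≤-refl ∷ desc-All (2 + k) (2 + e) (λ k+2≤ _ → <-trans (n<1+n k) k+2≤))
           (All.map (λ k<c → <⇒≤ k<c) cs-above)
  ... | β , ds , iter≡′ , len′ =
    β , ds , trans (iter-+ (suc k) k s witness) (trans (cong (iter (suc k) s) iter-k≡) iter≡′) , len′
    where
    iter-k≡ : iter k s witness ≡ (suc k ∷ high) ++ comb k cs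
    iter-k≡ = trans iter≡ (cong (λ x → (x ∷ high) ++ comb k cs) (+-identityʳ (suc k)))

  witness-InS : InS (suc k + (2 + e) + k) witness
  witness-InS = begin
    desc top k ++ desc 1 (suc k) ++ high
      ↭⟨ ↭.++⁺ (desc↭ top k) (↭.++⁺ (desc↭ 1 (suc k)) (desc↭ (2 + k) (2 + e))) ⟩
    A ++ B ++ C
      ↭⟨ ↭.++-comm A (B ++ C) ⟩
    (B ++ C) ++ A
      ≡⟨ cong (_++ A) (sym (applyUpTo-++ suc (suc k) (2 + e))) ⟩
    applyUpTo suc (suc k + (2 + e)) ++ A
      ≡⟨ sym (applyUpTo-++ suc (suc k + (2 + e)) k) ⟩
    applyUpTo suc (suc k + (2 + e) + k)
      ≡⟨ sym (map-upTo suc (suc k + (2 + e) + k)) ⟩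
    oneTo (suc k + (2 + e) + k) ∎
    where
    open PermutationReasoning
    A = applyUpTo (top +_) k
    B = applyUpTo (1 +_) (suc k)
    C = applyUpTo (2 + k +_) (2 + e)

Periodic-s : {π : List ℕ} → Periodic π → Periodic (s π)
Periodic-s {π} (K , 1≤K , iter≡) = K , 1≤K , trans (sym (iter-suc K s π)) (cong s iter≡)

Periodic-iter : {π : List ℕ} (i : ℕ) → Periodic π → Periodic (iter i s π)
Periodic-iter zero h = h
Periodic-iter (suc i) h = Periodic-s (Periodic-iter i h)

iter-period-multiple : {π : List ℕ} (K : ℕ) → iter K s π ≡ π → ∀ N → iter (N * K) s π ≡ π
iter-period-multiple K iter≡ zero = refl
iter-period-multiple {π} K iter≡ (suc N) =
  trans (iter-+ K (N * K) s π) (trans (cong (iter K s) (iter-period-multiple K iter≡ N)) iter≡)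

++-suffix : (xs xs′ : List ℕ) {ys ys′ : List ℕ} → xs ++ ys ≡ xs′ ++ ys′ → length ys ≡ length ys′ → ys ≡ ys′
++-suffix [] [] e _ = e
++-suffix [] (x′ ∷ xs′) {ys′ = ys′} refl len =
  ⊥-elim (m≢1+n+m (length ys′) (trans (sym len) (length-++ (x′ ∷ xs′))))
++-suffix (x ∷ xs) [] {ys} refl len =
  ⊥-elim (m≢1+n+m (length ys) (trans len (length-++ (x ∷ xs))))
++-suffix (x ∷ xs) (x′ ∷ xs′) e len = ++-suffix xs xs′ (∷-injectiveʳ e) len

-- After 2(k + 1) steps of s, the entry 2k + 1 positions from the end is a tooth exceeding k + 1.
comb-tail-not-periodic : {n k : ℕ} {π : List ℕ} (β ds : List ℕ) → InS n π → 3 + 2 * k ≤ n →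
  π ≡ β ++ suc k ∷ comb k ds → length ds ≡ k → ¬ Periodic π
comb-tail-not-periodic β ds p n≥ π≡ len (zero , () , _)
comb-tail-not-periodic {n} {k} {π} β ds p n≥ π≡ len (suc K , _ , iter≡)
  with after-2k-steps (InS-iter p (2 * suc k * K)) (suc k) (subst (λ z → 1 + z ≤ n) (sym (*-suc 2 k)) n≥)
... | comb-shape a α (c ∷ cs) shape _ (k+1<c ∷ _) len′ _ , _ = <-irrefl (sym c≡) k+1<c
  where
  N = 2 * suc k
  π≡iter : π ≡ iter N s (iter (N * K) s π)
  π≡iter = trans (sym (iter-period-multiple (suc K) iter≡ N))
             (trans (cong (λ z → iter z s π) (*-suc N K)) (iter-+ N (N * K) s π))
  split : ((a ∷ α) ++ [ suc k ]) ++ c ∷ comb k cs ≡ β ++ suc k ∷ comb k ds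
  split = trans (++-assoc (a ∷ α) [ suc k ] (c ∷ comb k cs)) (trans (sym shape) (trans (sym π≡iter) π≡))
  c≡ : c ≡ suc k
  c≡ = ∷-injectiveˡ (++-suffix ((a ∷ α) ++ [ suc k ]) β split
         (cong suc (trans (length-comb k cs (suc-injective len′)) (sym (length-comb k ds len)))))

lower-bound : {n : ℕ} (m : ℕ) → 1 + 2 * m ≤ n → (j : ℕ) → AllPeriodicAfter n j → 2 * m ≤ j
lower-bound zero _ j _ = z≤n
lower-bound {n} (suc k) n≥ j periodic with 2 * suc k ≤? j
... | yes 2m≤j = 2m≤j
... | no 2m≰j = ⊥-elim (comb-tail-not-periodic β ds (InS-iter p (suc k + k)) n≥′ iter≡ len periodic-after)
  where
  n≥′ : 3 + 2 * k ≤ n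
  n≥′ = subst (λ z → 1 + z ≤ n) (*-suc 2 k) n≥
  e = n ∸ (3 + 2 * k)
  n≡ : suc k + (2 + e) + k ≡ n
  n≡ = trans (solve 2 (λ k e → (con 1 :+ k) :+ (con 2 :+ e) :+ k := e :+ (con 3 :+ con 2 :* k)) refl k e)
             (m∸n+n≡m n≥′)
  open Witness k e
  p : InS n witness
  p = subst (λ z → InS z witness) n≡ witness-InS
  β = proj₁ witness-after
  ds = proj₁ (proj₂ witness-after)
  iter≡ = proj₁ (proj₂ (proj₂ witness-after))
  len = proj₂ (proj₂ (proj₂ witness-after))
  j≤ : j ≤ suc k + k
  j≤ = ≤-pred (subst (j <_) (solve 1 (λ k → con 2 :* (con 1 :+ k) := con 1 :+ ((con 1 :+ k) :+ k)) refl k)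
                             (≰⇒> 2m≰j))
  periodic-after : Periodic (iter (suc k + k) s witness)
  periodic-after =
    subst Periodic (trans (sym (iter-+ (suc k + k ∸ j) j s witness)) (cong (λ z → iter z s witness) (m∸n+n≡m j≤)))
      (Periodic-iter (suc k + k ∸ j) (periodic witness p))

theorem1p2 : (n : ℕ) → 1 ≤ n →
    AllPeriodicAfter n (2 * ((n ∸ 1) / 2))
      × ((k : ℕ) → AllPeriodicAfter n k → 2 * ((n ∸ 1) / 2) ≤ k)
theorem1p2 (suc n) _ = upper-bound {k = n / 2} lo hi , lower-bound (n / 2) lo
  where
  n≡ : suc n ≡ 1 + 2 * (n / 2) + n % 2
  n≡ = cong suc (trans (m≡m%n+[m/n]*n n 2)
                       (solve 2 (λ r q → r :+ q :* con 2 := con 2 :* q :+ r) refl (n % 2) (n / 2)))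
  lo : 1 + 2 * (n / 2) ≤ suc n
  lo = subst (1 + 2 * (n / 2) ≤_) (sym n≡) (m≤m+n _ _)
  hi : suc n ≤ 2 + 2 * (n / 2)
  hi = subst (_≤ 2 + 2 * (n / 2)) (sym n≡)
         (subst (_≤ 2 + 2 * (n / 2)) (+-comm (n % 2) _) (+-monoˡ-≤ (1 + 2 * (n / 2)) (≤-pred (m%n<n n 2))))
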